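{- Let $\mathcal{M}_1=\mathcal{U}_{1,2}(q)$ be the uniform $q$-matroid of rank $1$ on $\mathbb{F}_q^2$. Then $\mathcal{M}_1$ is representable over $\mathbb{F}_{q^2}$, whereas $\mathcal{M}_1\oplus\mathcal{M}_1$ is representable over $\mathbb{F}_{q^m}$ if and only if $m\ge4$.
   Context: A $q$-matroid with ground space $E$ (a finite-dimensional $\mathbb{F}_q$-vector space) is a pair $(E,\rho)$ with $\rho$ from the subspaces of $E$ to $\mathbb{N}_{\ge0}$ satisfying $0\le\rho(V)\le\dim V$, monotonicity, and submodularity $\rho(V+W)+\rho(V\cap W)\le\rho(V)+\rho(W)$. The uniform $q$-matroid $\mathcal{U}_{k,n}(q)$ has ground space $\mathbb{F}_q^n$ and rank function $\rho(V)=\min\{k,\dim V\}$. For $G\in\mathbb{F}_{q^m}^{k\times n}$, $\mathcal{M}_G=(\mathbb{F}_q^n,\rho_G)$ with $\rho_G(V)=\operatorname{rk}_{\mathbb{F}_{q^m}}(GY^{\mathsf T})$ for any $\mathbb{F}_q$-matrix $Y$ with $n$ columns and row space $V$. A $q$-matroid on $\mathbb{F}_q^n$ is representable over $\mathbb{F}_{q^m}$ if it equals (has the same rank function as) $\mathcal{M}_G$ for some matrix $G$ over $\mathbb{F}_{q^m}$ with $n$ columns. Direct sum: for $q$-matroids $\mathcal{M}_i=(\mathbb{F}_q^{n_i},\rho_i)$ and $n=n_1+n_2$, write $\mathbb{F}_q^n=\mathbb{F}_q^{n_1}\oplus\mathbb{F}_q^{n_2}$ with $\pi_1,\pi_2$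 the projections onto the first $n_1$ and last $n_2$ coordinates; put $\rho_i'(V)=\rho_i(\pi_i(V))$, $\mathcal{X}=\{X\le\mathbb{F}_q^n\mid\rho_1'(X)+\rho_2'(X)<\dim X\}$, $\mathcal{X}_0=\mathcal{X}\cup\{0\}$; then $\mathcal{M}_1\oplus\mathcal{M}_2=(\mathbb{F}_q^n,\rho)$ with $\rho(V)=\dim V+\min_{X\in\mathcal{X}_0,\,X\le V}(\rho_1'(X)+\rho_2'(X)-\dim X)$. -}

module Defs where

open import Level using (0ℓ)
open import Algebra.Bundles using (CommutativeRing)
open import Algebra.Morphism.Structures using (IsRingHomomorphism)
open import Data.Nat using (ℕ; _⊓_; _<_)
import Data.Nat as ℕ
open import Data.Integer as ℤ using (ℤ; +_)
open import Data.Fin using (Fin; _↑ˡ_; _↑ʳ_)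
import Data.Fin as Fin
open import Data.List using (List; length)
open import Data.Product using (Σ; ∃; _×_; _,_)
open import Data.Sum using (_⊎_)
open import Relation.Nullary using (¬_)
open import Relation.Binary.PropositionalEquality using (_≡_)
import Data.List.Relation.Unary.Unique.Setoid as USet
import Data.List.Membership.Setoid as MSet
open import Function.Bundles using (_⇔_)

record Field : Set₁ where
  field
    commutativeRing : CommutativeRing 0ℓ 0ℓ
  open CommutativeRing commutativeRing public
  field
    0#≉1#   : ¬ (0# ≈ 1#)
    inverse : ∀ x → ¬ (x ≈ 0#) → ∃ λ y → x * y ≈ 1#

HasSize : (K : Field) → ℕ → Set
HasSize K n =
  Σ (List Carrier) λ xs →
    length xs ≡ n × USet.Unique setoid xs × (∀ x → MSet._∈_ setoid x xs)
  where open Field K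

record Extension (F L : Field) : Set where
  field
    ι      : Field.Carrier F → Field.Carrier L
    isHom  : IsRingHomomorphism (Field.rawRing F) (Field.rawRing L) ι

Mat : Set → ℕ → ℕ → Set
Mat A r c = Fin r → Fin c → A

transpose : ∀ {A : Set} {r c} → Mat A r c → Mat A c r
transpose M j i = M i j

module _ (K : Field) where
  open Field K

  ∑ : ∀ {n} → (Fin n → Carrier) → Carrier
  ∑ {ℕ.zero}  f = 0#
  ∑ {ℕ.suc n} f = f Fin.zero + ∑ (λ i → f (Fin.suc i))

  mul : ∀ {k n s} → Mat Carrier k n → Mat Carrier n s → Mat Carrier k s
  mul A B i j = ∑ (λ l → A i l * B l j)

  Indep : ∀ {r n} → Mat Carrier r n → Set
  Indep {r} {n} v =
    (c : Fin r → Carrier) → (∀ j → ∑ (λ i → c i * v i j) ≈ 0#) → ∀ i → c i ≈ 0#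

  InRowSpace : ∀ {s n} → Mat Carrier s n → (Fin n → Carrier) → Set
  InRowSpace {s} M w = ∃ λ (c : Fin s → Carrier) → ∀ j → w j ≈ ∑ (λ i → c i * M i j)

  RowSub : ∀ {t s n} → Mat Carrier t n → Mat Carrier s n → Set
  RowSub X Y = ∀ i → InRowSpace Y (X i)

  RankIs : ∀ {s n} → Mat Carrier s n → ℕ → Set
  RankIs {s} {n} M r =
    (∃ λ (v : Mat Carrier r n) → Indep v × RowSub v M)
    × (∀ (w : Mat Carrier (ℕ.suc r) n) → RowSub w M → ¬ Indep w)

-- q-matroids on F^n, with subspaces V ≤ F^n given by a matrix Y whose
-- row space is V.  A rank function is encoded as the relation
-- "ρ(rowspace Y) = r".

RankRel : Field → ℕ → Set₁
RankRel F n = ∀ {s} → Mat (Field.Carrier F) s n → ℕ → Set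

Uniform : (F : Field) (k n : ℕ) → RankRel F n
Uniform F k n Y r = ∃ λ d → RankIs F Y d × r ≡ k ⊓ d

module _ (F : Field) {n₁ n₂ : ℕ} where
  open Field F using (Carrier)

  π₁ : ∀ {s} → Mat Carrier s (n₁ ℕ.+ n₂) → Mat Carrier s n₁
  π₁ X i j = X i (j ↑ˡ n₂)

  π₂ : ∀ {s} → Mat Carrier s (n₁ ℕ.+ n₂) → Mat Carrier s n₂
  π₂ X i j = X i (n₁ ↑ʳ j)

  DirectSum : RankRel F n₁ → RankRel F n₂ → RankRel F (n₁ ℕ.+ n₂)
  DirectSum ρ₁ ρ₂ {s} Y r =
    ∃ λ d → RankIs F Y d × ∃ λ μ → (Attained μ × Lower μ) × (+ r ≡ + d ℤ.+ μ)
    where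
      Value : ∀ {t} → Mat Carrier t (n₁ ℕ.+ n₂) → ℤ → Set
      Value X ν = ∃ λ a₁ → ∃ λ a₂ → ∃ λ dX →
        ρ₁ (π₁ X) a₁ × ρ₂ (π₂ X) a₂ × RankIs F X dX × ν ≡ (+ a₁ ℤ.+ + a₂) ℤ.- + dX
      InX₀ : ∀ {t} → Mat Carrier t (n₁ ℕ.+ n₂) → Set
      InX₀ X = RankIs F X 0
             ⊎ (∃ λ a₁ → ∃ λ a₂ → ∃ λ dX →
                  ρ₁ (π₁ X) a₁ × ρ₂ (π₂ X) a₂ × RankIs F X dX × a₁ ℕ.+ a₂ < dX)
      Attained : ℤ → Set
      Attained μ = ∃ λ t → Σ (Mat Carrier t (n₁ ℕ.+ n₂)) λ X →
        RowSub F X Y × InX₀ X × Value X μ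
      Lower : ℤ → Set
      Lower μ = ∀ {t} (X : Mat Carrier t (n₁ ℕ.+ n₂)) → RowSub F X Y → InX₀ X →
        ∀ ν → Value X ν → μ ℤ.≤ ν

RepRank : (F L : Field) → Extension F L → ∀ {k n} →
          Mat (Field.Carrier L) k n → RankRel F n
RepRank F L E G Y r = RankIs L (mul L G (transpose (λ i j → ι (Y i j)))) r
  where open Extension E

Representable : (F L : Field) → Extension F L → ∀ {n} → RankRel F n → Set
Representable F L E {n} ρ =
  ∃ λ k → Σ (Mat (Field.Carrier L) k n) λ G →
    ∀ {s} (Y : Mat (Field.Carrier F) s n) (r : ℕ) → (ρ Y r ⇔ RepRank F L E G Y r)

{-# OPTIONS --safe #-}
module Submission where

-- Let α ∈ L lie outside F. Then (a₀, a₁) ↦ a₀ + αa₁ is injective on F², so G = (1 α) represents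
-- U₁,₂(q); such α exists as soon as |L| > q.
--
-- In U₁,₂ ⊕ U₁,₂ a space V has rank min(ρ₁'(V) + ρ₂'(V), dim V), where ρᵢ'(V) = min(1, rank πᵢV).
-- If moreover β avoids the at most q³ + q² ratios (a₀ + αa₁)/(b₀ + αb₁), so that 1, α, β, αβ are
-- linearly independent over F, the matrix with rows (1, α, 0, 0) and (0, 0, 1, β) has exactly this
-- rank function; the counting works when q^m > q³ + q², i.e. m ≥ 4.
--
-- Conversely, if G represents U₁,₂ ⊕ U₁,₂ then ⟨e₀, e₁⟩ and ⟨e₂, e₃⟩ have rank 1, so the columns
-- satisfy g₁ = αg₀, g₃ = βg₂. A nontrivial F-relation among 1, α, β, αβ would yield a plane with
-- both projections nonzero but rank 1, so F⁴ embeds in L and m ≥ 4.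

open import Defs
open import Algebra.Morphism.Structures using (IsRingHomomorphism)
import Algebra.Properties.Ring as RingP
import Algebra.Properties.AbelianGroup as AGP
import Algebra.Properties.CommutativeSemigroup as CSP
import Algebra.Properties.Group as GP
open import Data.Empty using (⊥; ⊥-elim)
open import Data.Fin as Fin using (Fin; zero; suc; _↑ˡ_; _↑ʳ_; finToFun; funToFin)
import Data.Fin.Properties as FinP
open import Data.Integer as ℤ using (ℤ; +_)
import Data.Integer.Properties as ZP
open import Data.List using (List; []; _∷_; length; lookup)
import Data.List.Relation.Unary.Any as Any
import Data.List.Relation.Unary.Any.Properties as AnyP
open import Data.List.Relation.Unary.All using (All; []; _∷_)
open import Data.List.Relation.Unary.AllPairs using (AllPairs; []; _∷_)
open import Data.Nat as ℕ using (ℕ; zero; suc; _^_; _⊓_; _≤_; _<_; z≤n; s≤s)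
import Data.Nat.Properties as NP
open import Data.Product using (∃; _×_; _,_; proj₁; proj₂)
open import Data.Sum using (_⊎_; inj₁; inj₂)
open import Data.Vec.Functional using (Vector; _++_)
import Data.Vec.Functional as V
open import Data.Vec.Functional.Properties using (lookup-++ˡ; lookup-++ʳ)
open import Function.Bundles using (_⇔_; mk⇔; Equivalence)
open import Relation.Nullary using (¬_; Dec; yes; no)
open import Relation.Nullary.Decidable using (_×-dec_; _→-dec_; ¬?; toWitness)
open import Relation.Binary.PropositionalEquality as P using (_≡_; _≢_)

-- Linear algebra over a finite field

pattern f0 = zero
pattern f1 = suc zero
pattern f2 = suc (suc zero)
pattern f3 = suc (suc (suc zero))

module FieldProperties (K : Field) where
  open Field K public hiding (zero)
  open RingP ring public using (-1*x≈-x; -‿distribˡ-*; -‿distribʳ-*; -‿involutive; -0#≈0#; x[y-z]≈xy-xz; [y-z]x≈yx-zx)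
  open AGP +-abelianGroup public using (⁻¹-∙-comm)
  open GP +-group public using (inverseˡ-unique; x∙y⁻¹≈ε⇒x≈y; x≈y⇒x∙y⁻¹≈ε)
  open CSP +-commutativeSemigroup public using (interchange)
  open CSP *-commutativeSemigroup public using (x∙yz≈y∙xz)
  open import Relation.Binary.Reasoning.Setoid setoid

  _≋_ : ∀ {n} → Vector Carrier n → Vector Carrier n → Set
  u ≋ v = ∀ i → u i ≈ v i

  1≉0 : ¬ 1# ≈ 0#
  1≉0 e = 0#≉1# (sym e)

  -1≉0 : ¬ - 1# ≈ 0#
  -1≉0 e = 1≉0 (trans (sym (-‿involutive 1#)) (trans (-‿cong e) -0#≈0#))

  x*-1≈-x : ∀ x → x * - 1# ≈ - x
  x*-1≈-x x = trans (*-comm _ _) (-1*x≈-x x)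

  inv : ∀ x → ¬ x ≈ 0# → Carrier
  inv x x≉0 = proj₁ (inverse x x≉0)

  *-inverseʳ : ∀ x (x≉0 : ¬ x ≈ 0#) → x * inv x x≉0 ≈ 1#
  *-inverseʳ x x≉0 = proj₂ (inverse x x≉0)

  *-inverseˡ : ∀ x (x≉0 : ¬ x ≈ 0#) → inv x x≉0 * x ≈ 1#
  *-inverseˡ x x≉0 = trans (*-comm _ _) (*-inverseʳ x x≉0)

  inv≉0 : ∀ x (x≉0 : ¬ x ≈ 0#) → ¬ inv x x≉0 ≈ 0#
  inv≉0 x x≉0 e = 0#≉1# (trans (sym (trans (*-congʳ e) (zeroˡ x))) (*-inverseˡ x x≉0))

  *-cancelˡ : ∀ x {y z} → ¬ x ≈ 0# → x * y ≈ x * z → y ≈ z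
  *-cancelˡ x {y} {z} x≉0 e = begin
    y                      ≈⟨ *-identityˡ y ⟨
    1# * y                 ≈⟨ *-congʳ (*-inverseˡ x x≉0) ⟨
    (inv x x≉0 * x) * y    ≈⟨ *-assoc _ _ _ ⟩
    inv x x≉0 * (x * y)    ≈⟨ *-congˡ e ⟩
    inv x x≉0 * (x * z)    ≈⟨ *-assoc _ _ _ ⟨
    (inv x x≉0 * x) * z    ≈⟨ *-congʳ (*-inverseˡ x x≉0) ⟩
    1# * z                 ≈⟨ *-identityˡ z ⟩
    z                      ∎

  x*y≈0⇒y≈0 : ∀ {x y} → ¬ x ≈ 0# → x * y ≈ 0# → y ≈ 0#
  x*y≈0⇒y≈0 {x} x≉0 e = *-cancelˡ x x≉0 (trans e (sym (zeroʳ x)))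

  *-≉0 : ∀ {x y} → ¬ x ≈ 0# → ¬ y ≈ 0# → ¬ x * y ≈ 0#
  *-≉0 x≉0 y≉0 e = y≉0 (x*y≈0⇒y≈0 x≉0 e)

  dependent⇒minors≈ : ∀ {n} (u v : Vector Carrier n) c₀ c₁ → ¬ c₀ ≈ 0# →
                      (∀ j → c₀ * u j + c₁ * v j ≈ 0#) → ∀ j k → u j * v k ≈ u k * v j
  dependent⇒minors≈ u v c₀ c₁ c₀≉0 dependence j k = *-cancelˡ c₀ c₀≉0 (begin
    c₀ * (u j * v k)      ≈⟨ *-assoc _ _ _ ⟨
    (c₀ * u j) * v k      ≈⟨ *-congʳ (c₀u≈-c₁v j) ⟩
    - (c₁ * v j) * v k    ≈⟨ -‿distribˡ-* _ _ ⟨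
    - ((c₁ * v j) * v k)  ≈⟨ -‿cong (trans (*-assoc _ _ _) (trans (*-congˡ (*-comm _ _)) (sym (*-assoc _ _ _)))) ⟩
    - ((c₁ * v k) * v j)  ≈⟨ -‿distribˡ-* _ _ ⟩
    - (c₁ * v k) * v j    ≈⟨ *-congʳ (c₀u≈-c₁v k) ⟨
    (c₀ * u k) * v j      ≈⟨ *-assoc _ _ _ ⟩
    c₀ * (u k * v j)      ∎)
    where
    c₀u≈-c₁v : ∀ j → c₀ * u j ≈ - (c₁ * v j)
    c₀u≈-c₁v j = inverseˡ-unique _ _ (dependence j)

  [a-b]+[c-d]≈[a+c]-[b+d] : ∀ a b c d → (a - b) + (c - d) ≈ (a + c) - (b + d)
  [a-b]+[c-d]≈[a+c]-[b+d] a b c d = trans (interchange a (- b) c (- d)) (+-congˡ (⁻¹-∙-comm b d))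

  sum : ∀ {n} → Vector Carrier n → Carrier
  sum = ∑ K

  sum-cong : ∀ {n} {f g : Vector Carrier n} → f ≋ g → sum f ≈ sum g
  sum-cong {zero}  e = refl
  sum-cong {suc n} e = +-cong (e zero) (sum-cong (λ i → e (suc i)))

  sum-zero : ∀ {n} (f : Vector Carrier n) → (∀ i → f i ≈ 0#) → sum f ≈ 0#
  sum-zero {zero}  f e = refl
  sum-zero {suc n} f e = trans (+-cong (e zero) (sum-zero (λ i → f (suc i)) (λ i → e (suc i)))) (+-identityˡ 0#)

  sum-+ : ∀ {n} (f g : Vector Carrier n) → sum (λ i → f i + g i) ≈ sum f + sum g
  sum-+ {zero}  f g = sym (+-identityˡ 0#)
  sum-+ {suc n} f g = trans (+-congˡ (sum-+ (λ i → f (suc i)) (λ i → g (suc i)))) (interchange _ _ _ _)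

  sum-*ˡ : ∀ {n} c (f : Vector Carrier n) → c * sum f ≈ sum (λ i → c * f i)
  sum-*ˡ {zero}  c f = zeroʳ c
  sum-*ˡ {suc n} c f = trans (distribˡ c _ _) (+-congˡ (sum-*ˡ c (λ i → f (suc i))))

  sum-*ʳ : ∀ {n} (f : Vector Carrier n) c → sum f * c ≈ sum (λ i → f i * c)
  sum-*ʳ {n} f c = trans (*-comm _ _) (trans (sum-*ˡ c f) (sum-cong {n} (λ i → *-comm _ _)))

  sum-neg : ∀ {n} (f : Vector Carrier n) → - sum f ≈ sum (λ i → - f i)
  sum-neg {zero}  f = -0#≈0#
  sum-neg {suc n} f = trans (sym (⁻¹-∙-comm _ _)) (+-congˡ (sum-neg (λ i → f (suc i))))

  sum-swap : ∀ {m n} (f : Fin m → Fin n → Carrier) →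
             sum (λ i → sum (λ j → f i j)) ≈ sum (λ j → sum (λ i → f i j))
  sum-swap {zero}  {n} f = sym (sum-zero {n} (λ j → 0#) (λ _ → refl))
  sum-swap {suc m} {n} f = begin
    sum (λ j → f zero j) + sum (λ i → sum (λ j → f (suc i) j)) ≈⟨ +-congˡ (sum-swap (λ i → f (suc i))) ⟩
    sum (λ j → f zero j) + sum (λ j → sum (λ i → f (suc i) j)) ≈⟨ sum-+ {n} _ _ ⟨
    sum (λ j → f zero j + sum (λ i → f (suc i) j))             ∎

  sum-split : ∀ {a b} (f : Vector Carrier (a ℕ.+ b)) →
              sum f ≈ sum (λ i → f (i ↑ˡ b)) + sum (λ i → f (a ↑ʳ i))
  sum-split {zero}      f = sym (+-identityˡ _)
  sum-split {suc a} {b} f = trans (+-congˡ (sum-split {a} {b} (λ i → f (suc i)))) (sym (+-assoc _ _ _))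

  δ : ∀ {n} → Fin n → Fin n → Carrier
  δ i j with i FinP.≟ j
  ... | yes _ = 1#
  ... | no  _ = 0#

  δ-sym : ∀ {n} (i j : Fin n) → δ i j ≈ δ j i
  δ-sym i j with i FinP.≟ j | j FinP.≟ i
  ... | yes _ | yes _ = refl
  ... | no  _ | no  _ = refl
  ... | yes e | no ne = ⊥-elim (ne (P.sym e))
  ... | no ne | yes e = ⊥-elim (ne (P.sym e))

  sum-δ : ∀ {n} (k : Fin n) (f : Vector Carrier n) → sum (λ i → δ k i * f i) ≈ f k
  sum-δ {suc n} zero f = begin
    1# * f zero + sum (λ i → δ zero (suc i) * f (suc i)) ≈⟨ +-cong (*-identityˡ _) (sum-zero {n} _ (λ i → zeroˡ _)) ⟩
    f zero + 0#                                          ≈⟨ +-identityʳ _ ⟩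
    f zero                                               ∎
  sum-δ {suc n} (suc k) f = begin
    δ (suc k) zero * f zero + sum (λ i → δ (suc k) (suc i) * f (suc i))
      ≈⟨ +-cong (zeroˡ _) (sum-cong (λ i → *-congʳ (δ-suc i))) ⟩
    0# + sum (λ i → δ k i * f (suc i))                                  ≈⟨ +-identityˡ _ ⟩
    sum (λ i → δ k i * f (suc i))                                       ≈⟨ sum-δ k (λ i → f (suc i)) ⟩
    f (suc k)                                                           ∎
    where
    δ-suc : ∀ i → δ (suc k) (suc i) ≈ δ k i
    δ-suc i with k FinP.≟ i
    ... | yes _ = refl
    ... | no  _ = refl

lookup-All : ∀ {A : Set} {Q : A → Set} {xs : List A} → All Q xs → (i : Fin (length xs)) → Q (lookup xs i)
lookup-All (p ∷ ps) zero    = p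
lookup-All (p ∷ ps) (suc i) = lookup-All ps i

funToFin-cong : ∀ {m n} (f g : Fin m → Fin n) → (∀ k → f k ≡ g k) → funToFin f ≡ funToFin g
funToFin-cong {zero}  f g e = P.refl
funToFin-cong {suc m} f g e = P.cong₂ Fin.combine (e zero) (funToFin-cong (λ k → f (suc k)) (λ k → g (suc k)) (λ k → e (suc k)))

module _ (K : Field) where
  open FieldProperties K

  record Enumeration (N : ℕ) : Set where
    field
      element           : Fin N → Carrier
      index             : Carrier → Fin N
      element-index     : ∀ x → x ≈ element (index x)
      element-injective : ∀ {i j} → element i ≈ element j → i ≡ j

  lookup-injective : ∀ (ys : List Carrier) → AllPairs (λ x y → ¬ x ≈ y) ys →
                     ∀ {i j} → lookup ys i ≈ lookup ys j → i ≡ j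
  lookup-injective (y ∷ ys) (p ∷ ps) {zero}  {zero}  e = P.refl
  lookup-injective (y ∷ ys) (p ∷ ps) {zero}  {suc j} e = ⊥-elim (lookup-All p j e)
  lookup-injective (y ∷ ys) (p ∷ ps) {suc i} {zero}  e = ⊥-elim (lookup-All p i (sym e))
  lookup-injective (y ∷ ys) (p ∷ ps) {suc i} {suc j} e = P.cong suc (lookup-injective ys ps e)

  enumeration : ∀ {N} → HasSize K N → Enumeration N
  enumeration (xs , P.refl , unique , complete) = record
    { element           = lookup xs
    ; index             = λ x → Any.index (complete x)
    ; element-index     = λ x → AnyP.lookup-index (complete x)
    ; element-injective = lookup-injective xs unique
    }

distinct⇒1<n : ∀ {n} (a b : Fin n) → a ≢ b → 1 < n
distinct⇒1<n {suc zero}    zero zero a≢b = ⊥-elim (a≢b P.refl)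
distinct⇒1<n {suc (suc n)} a    b    a≢b = s≤s (s≤s z≤n)

module FiniteField (K : Field) {N : ℕ} (hs : HasSize K N) where
  open FieldProperties K
  open Enumeration (enumeration K hs) public

  infix 4 _≟_
  _≟_ : ∀ x y → Dec (x ≈ y)
  x ≟ y with index x FinP.≟ index y
  ... | yes e = yes (trans (element-index x) (trans (reflexive (P.cong element e)) (sym (element-index y))))
  ... | no ne = no (λ e → ne (element-injective (trans (sym (element-index x)) (trans e (element-index y)))))

  1<N : 1 < N
  1<N = distinct⇒1<n (index 0#) (index 1#)
    (λ e → 0#≉1# (trans (element-index 0#) (trans (reflexive (P.cong element e)) (sym (element-index 1#)))))

  vector : ∀ {r} → Fin (N ^ r) → Vector Carrier r
  vector i k = element (finToFun i k)

  code : ∀ {r} → Vector Carrier r → Fin (N ^ r)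
  code c = funToFin (λ k → index (c k))

  vector-code : ∀ {r} (c : Vector Carrier r) → c ≋ vector (code c)
  vector-code c k =
    trans (element-index (c k)) (reflexive (P.cong element (P.sym (FinP.finToFun-funToFin (λ k → index (c k)) k))))

  vector-injective : ∀ {r} {i j : Fin (N ^ r)} → vector i ≋ vector j → i ≡ j
  vector-injective {r} {i} {j} e = P.trans (P.sym (FinP.funToFin-finToFin {r} i))
     (P.trans (funToFin-cong {r} (finToFun i) (finToFun j) (λ k → element-injective (e k))) (FinP.funToFin-finToFin {r} j))

  any-vector? : ∀ {r} {Pr : Vector Carrier r → Set} → (∀ {c c'} → c ≋ c' → Pr c → Pr c') →
                (∀ c → Dec (Pr c)) → Dec (∃ λ c → Pr c)
  any-vector? {r} resp Pr? with FinP.any? (λ i → Pr? (vector {r} i))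
  ... | yes (i , p) = yes (vector i , p)
  ... | no ¬p = no (λ { (c , pc) → ¬p (code c , resp (vector-code c) pc) })

  vector-pigeonhole : ∀ {r M} (g : Fin (N ^ r) → Fin M) → M < N ^ r → (∀ {i j} → g i ≡ g j → vector {r} i ≋ vector j) → ⊥
  vector-pigeonhole {r} g M<N^r g-inj with FinP.pigeonhole M<N^r g
  ... | i , j , i<j , e = FinP.<-irrefl (vector-injective {r} (g-inj {i} {j} e)) i<j

  injects-into-smaller⇒∃¬ : ∀ {Bad : Carrier → Set} → (∀ x → Dec (Bad x)) → ∀ {M} → M < N →
                            (key : ∀ x → Bad x → Fin M) → (∀ {x y bx by} → key x bx ≡ key y by → x ≈ y) →
                            ∃ λ x → ¬ Bad x
  injects-into-smaller⇒∃¬ {Bad} Bad? M<N key key-inj with FinP.all? (λ i → Bad? (element i))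
  ... | no ¬all = let (i , ¬bad) = FinP.¬∀⟶∃¬ N _ (λ i → Bad? (element i)) ¬all in element i , ¬bad
  ... | yes all with FinP.pigeonhole M<N (λ i → key (element i) (all i))
  ...   | i , j , i<j , e = ⊥-elim (FinP.<-irrefl (element-injective (key-inj e)) i<j)

module LinearAlgebra (K : Field) {N : ℕ} (hs : HasSize K N) where
  open FieldProperties K
  open FiniteField K hs
  open import Relation.Binary.Reasoning.Setoid setoid

  Matrix : ℕ → ℕ → Set
  Matrix r n = Mat Carrier r n

  lincomb : ∀ {r n} → Vector Carrier r → Matrix r n → Vector Carrier n
  lincomb c M j = sum (λ i → c i * M i j)

  lincomb-cong : ∀ {r n} {a b : Vector Carrier r} (M : Matrix r n) → a ≋ b → lincomb a M ≋ lincomb b M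
  lincomb-cong {r} M a≋b j = sum-cong {r} (λ k → *-congʳ (a≋b k))

  lincomb-sub : ∀ {r n} (a b : Vector Carrier r) (M : Matrix r n) →
                lincomb (λ k → a k - b k) M ≋ (λ j → lincomb a M j - lincomb b M j)
  lincomb-sub {r} a b M j = begin
    sum (λ k → (a k - b k) * M k j)                       ≈⟨ sum-cong {r} (λ k → [y-z]x≈yx-zx (M k j) (a k) (b k)) ⟩
    sum (λ k → a k * M k j + - (b k * M k j))             ≈⟨ sum-+ {r} _ _ ⟩
    sum (λ k → a k * M k j) + sum (λ k → - (b k * M k j)) ≈⟨ +-congˡ (sum-neg {r} _) ⟨
    lincomb a M j - lincomb b M j                         ∎

  InRowSpace-resp : ∀ {s n} (M : Matrix s n) {w w' : Vector Carrier n} → w ≋ w' → InRowSpace K M w → InRowSpace K M w'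
  InRowSpace-resp M w≋w' (c , w≈cM) = c , λ j → trans (sym (w≋w' j)) (w≈cM j)

  row∈RowSpace : ∀ {s n} (M : Matrix s n) k → InRowSpace K M (M k)
  row∈RowSpace M k = δ k , λ j → sym (sum-δ k (λ i → M i j))

  RowSub-refl : ∀ {s n} (M : Matrix s n) → RowSub K M M
  RowSub-refl M = row∈RowSpace M

  lincomb∈RowSpace : ∀ {r s n} (Y : Matrix r n) (Z : Matrix s n) → RowSub K Y Z →
                     (a : Vector Carrier r) → InRowSpace K Z (lincomb a Y)
  lincomb∈RowSpace {r} {s} Y Z Y⊆Z a = (λ m → sum (λ l → a l * b l m)) , λ j → begin
    sum (λ l → a l * Y l j)                       ≈⟨ sum-cong {r} (λ l → *-congˡ (proj₂ (Y⊆Z l) j)) ⟩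
    sum (λ l → a l * sum (λ m → b l m * Z m j))   ≈⟨ sum-cong {r} (λ l → sum-*ˡ {s} (a l) _) ⟩
    sum (λ l → sum (λ m → a l * (b l m * Z m j))) ≈⟨ sum-swap {r} {s} _ ⟩
    sum (λ m → sum (λ l → a l * (b l m * Z m j))) ≈⟨ sum-cong {s} (λ m → sum-cong {r} (λ l → sym (*-assoc _ _ _))) ⟩
    sum (λ m → sum (λ l → (a l * b l m) * Z m j)) ≈⟨ sum-cong {s} (λ m → sym (sum-*ʳ {r} _ _)) ⟩
    sum (λ m → sum (λ l → a l * b l m) * Z m j)   ∎
    where
    b : Fin r → Fin s → Carrier
    b l = proj₁ (Y⊆Z l)

  InRowSpace-trans : ∀ {r s n} (Y : Matrix r n) (Z : Matrix s n) → RowSub K Y Z →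
                     ∀ {w} → InRowSpace K Y w → InRowSpace K Z w
  InRowSpace-trans Y Z Y⊆Z (a , w≈aY) = InRowSpace-resp Z (λ j → sym (w≈aY j)) (lincomb∈RowSpace Y Z Y⊆Z a)

  RowSub-trans : ∀ {t r s n} (X : Matrix t n) (Y : Matrix r n) (Z : Matrix s n) →
                 RowSub K X Y → RowSub K Y Z → RowSub K X Z
  RowSub-trans X Y Z X⊆Y Y⊆Z i = InRowSpace-trans Y Z Y⊆Z (X⊆Y i)

  InRowSpace? : ∀ {s n} (M : Matrix s n) (w : Vector Carrier n) → Dec (InRowSpace K M w)
  InRowSpace? {s} M w = any-vector? (λ c≋c' w≈cM j → trans (w≈cM j) (lincomb-cong M c≋c' j))
                                    (λ c → FinP.all? (λ j → w j ≟ lincomb c M j))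

  _∷ₘ_ : ∀ {r n} → Vector Carrier n → Matrix r n → Matrix (suc r) n
  (x ∷ₘ M) zero    = x
  (x ∷ₘ M) (suc i) = M i

  Indep-∷ : ∀ {r n} (M : Matrix r n) (x : Vector Carrier n) → Indep K M → ¬ InRowSpace K M x → Indep K (x ∷ₘ M)
  Indep-∷ {r} M x M-indep x∉M c cxM≈0 = coefficient≈0
    where
    S : ∀ j → Carrier
    S j = sum (λ i → c (suc i) * M i j)
    head≈0 : c zero ≈ 0#
    head≈0 with c zero ≟ 0#
    ... | yes c₀≈0 = c₀≈0
    ... | no  c₀≉0 = ⊥-elim (x∉M ((λ i → - inv (c zero) c₀≉0 * c (suc i)) , λ j → begin
          x j                                               ≈⟨ *-identityˡ _ ⟨
          1# * x j                                          ≈⟨ *-congʳ (*-inverseˡ _ c₀≉0) ⟨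
          (inv (c zero) c₀≉0 * c zero) * x j                ≈⟨ *-assoc _ _ _ ⟩
          inv (c zero) c₀≉0 * (c zero * x j)                ≈⟨ *-congˡ (inverseˡ-unique _ _ (cxM≈0 j)) ⟩
          inv (c zero) c₀≉0 * (- S j)                       ≈⟨ -‿distribʳ-* _ _ ⟨
          - (inv (c zero) c₀≉0 * S j)                       ≈⟨ -‿distribˡ-* _ _ ⟩
          - inv (c zero) c₀≉0 * S j                         ≈⟨ sum-*ˡ {r} _ _ ⟩
          sum (λ i → - inv (c zero) c₀≉0 * (c (suc i) * M i j)) ≈⟨ sum-cong {r} (λ i → sym (*-assoc _ _ _)) ⟩
          sum (λ i → (- inv (c zero) c₀≉0 * c (suc i)) * M i j) ∎))
    tail≈0 : ∀ i → c (suc i) ≈ 0#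
    tail≈0 = M-indep (λ i → c (suc i)) (λ j → begin
          S j                ≈⟨ +-identityˡ _ ⟨
          0# + S j           ≈⟨ +-congʳ (trans (*-congʳ head≈0) (zeroˡ (x j))) ⟨
          c zero * x j + S j ≈⟨ cxM≈0 j ⟩
          0#                 ∎)
    coefficient≈0 : ∀ i → c i ≈ 0#
    coefficient≈0 zero    = head≈0
    coefficient≈0 (suc i) = tail≈0 i

  -- Counting: a ↦ (coordinates of a·w along v) maps K^r injectively into K^d, as w is independent.
  Indep∧RowSub⇒≤ : ∀ {r d n} (w : Matrix r n) (v : Matrix d n) → Indep K w → RowSub K w v → r ≤ d
  Indep∧RowSub⇒≤ {r} {d} w v w-indep w⊆v with r NP.≤? d
  ... | yes r≤d = r≤d
  ... | no  r≰d = ⊥-elim (vector-pigeonhole {r} coordinates (NP.^-monoʳ-< N 1<N (NP.≰⇒> r≰d)) injective)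
    where
    coords : Fin (N ^ r) → Vector Carrier d
    coords i = proj₁ (lincomb∈RowSpace w v w⊆v (vector {r} i))
    coordinates : Fin (N ^ r) → Fin (N ^ d)
    coordinates i = code (coords i)
    injective : ∀ {i j} → coordinates i ≡ coordinates j → vector {r} i ≋ vector j
    injective {i} {j} e k = x∙y⁻¹≈ε⇒x≈y _ _ (w-indep (λ k → vector i k - vector j k) difference≈0 k)
      where
      coords≋ : coords i ≋ coords j
      coords≋ k = trans (vector-code (coords i) k)
                        (trans (reflexive (P.cong (λ z → vector z k) e)) (sym (vector-code (coords j) k)))
      same : ∀ l → lincomb (vector i) w l ≈ lincomb (vector j) w l
      same l = trans (proj₂ (lincomb∈RowSpace w v w⊆v (vector i)) l)
                 (trans (lincomb-cong v coords≋ l) (sym (proj₂ (lincomb∈RowSpace w v w⊆v (vector j)) l)))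
      difference≈0 : ∀ l → lincomb (λ k → vector i k - vector j k) w l ≈ 0#
      difference≈0 l = trans (lincomb-sub (vector i) (vector j) w l) (x≈y⇒x∙y⁻¹≈ε (same l))

  Basis : ∀ {s n} → Matrix s n → ℕ → Set
  Basis {s} {n} M d = ∃ λ (v : Matrix d n) → Indep K v × RowSub K v M × RowSub K M v

  basis⇒rank : ∀ {s n} (M : Matrix s n) {d} → Basis M d → RankIs K M d
  basis⇒rank M {d} (v , v-indep , v⊆M , M⊆v) = (v , v-indep , v⊆M) , λ w w⊆M w-indep →
    NP.<-irrefl P.refl (Indep∧RowSub⇒≤ w v w-indep (RowSub-trans w M v w⊆M M⊆v))

  rank⇒basis : ∀ {s n} (M : Matrix s n) {d} → RankIs K M d → Basis M d
  rank⇒basis M {d} ((v , v-indep , v⊆M) , maximal) = v , v-indep , v⊆M , M⊆v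
    where
    M⊆v : RowSub K M v
    M⊆v i with InRowSpace? v (M i)
    ... | yes Mi∈v = Mi∈v
    ... | no  Mi∉v = ⊥-elim (maximal (M i ∷ₘ v) Mi∷v⊆M (Indep-∷ v (M i) v-indep Mi∉v))
      where
      Mi∷v⊆M : RowSub K (M i ∷ₘ v) M
      Mi∷v⊆M zero    = row∈RowSpace M i
      Mi∷v⊆M (suc k) = v⊆M k

  tailₘ : ∀ {s n} → Matrix (suc s) n → Matrix s n
  tailₘ M i = M (suc i)

  RowSub-tail : ∀ {t s n} (X : Matrix t n) (M : Matrix (suc s) n) → RowSub K X (tailₘ M) → RowSub K X M
  RowSub-tail X M X⊆M' i = c , λ j → trans (proj₂ (X⊆M' i) j) (sym (trans (+-congʳ (zeroˡ _)) (+-identityˡ _)))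
    where
    c : Vector Carrier _
    c zero    = 0#
    c (suc k) = proj₁ (X⊆M' i) k

  basis-exists : ∀ {s n} (M : Matrix s n) → ∃ λ d → Basis M d
  basis-exists {zero}  M = 0 , (λ ()) , (λ c h ()) , (λ ()) , (λ ())
  basis-exists {suc s} M with basis-exists (tailₘ M)
  ... | d , v , v-indep , v⊆M' , M'⊆v with InRowSpace? v (M zero)
  ...   | yes M₀∈v = d , v , v-indep , RowSub-tail v M v⊆M' , M⊆v
    where
    M⊆v : RowSub K M v
    M⊆v zero    = M₀∈v
    M⊆v (suc i) = M'⊆v i
  ...   | no M₀∉v = suc d , (M zero ∷ₘ v) , Indep-∷ v (M zero) v-indep M₀∉v , M₀∷v⊆M , M⊆M₀∷v
    where
    M₀∷v⊆M : RowSub K (M zero ∷ₘ v) M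
    M₀∷v⊆M zero    = row∈RowSpace M zero
    M₀∷v⊆M (suc k) = RowSub-tail v M v⊆M' k
    M⊆M₀∷v : RowSub K M (M zero ∷ₘ v)
    M⊆M₀∷v zero    = row∈RowSpace (M zero ∷ₘ v) zero
    M⊆M₀∷v (suc i) = InRowSpace-trans v (M zero ∷ₘ v) (RowSub-tail v (M zero ∷ₘ v) (RowSub-refl v)) (M'⊆v i)

  rank-exists : ∀ {s n} (M : Matrix s n) → ∃ λ d → RankIs K M d
  rank-exists M = proj₁ (basis-exists M) , basis⇒rank M (proj₂ (basis-exists M))

  rank-unique : ∀ {s n} (M : Matrix s n) {d d'} → RankIs K M d → RankIs K M d' → d ≡ d'
  rank-unique M r r' with rank⇒basis M r | rank⇒basis M r'
  ... | v , v-indep , v⊆M , M⊆v | v' , v'-indep , v'⊆M , M⊆v' =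
    NP.≤-antisym (Indep∧RowSub⇒≤ v v' v-indep (RowSub-trans v M v' v⊆M M⊆v'))
                 (Indep∧RowSub⇒≤ v' v v'-indep (RowSub-trans v' M v v'⊆M M⊆v))

  rank-mono : ∀ {t s n} (X : Matrix t n) (Y : Matrix s n) → RowSub K X Y →
              ∀ {dx dy} → RankIs K X dx → RankIs K Y dy → dx ≤ dy
  rank-mono X Y X⊆Y rx ry with rank⇒basis X rx | rank⇒basis Y ry
  ... | vx , vx-indep , vx⊆X , _ | vy , _ , _ , Y⊆vy =
    Indep∧RowSub⇒≤ vx vy vx-indep (RowSub-trans vx Y vy (RowSub-trans vx X Y vx⊆X X⊆Y) Y⊆vy)

  RowSub∧rank≡⇒RowSub : ∀ {t s n} (X : Matrix t n) (Y : Matrix s n) → RowSub K X Y →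
                         ∀ {d} → RankIs K X d → RankIs K Y d → RowSub K Y X
  RowSub∧rank≡⇒RowSub X Y X⊆Y {d} rx ry i with rank⇒basis X rx | rank⇒basis Y ry
  ... | vx , vx-indep , vx⊆X , _ | vy , _ , _ , Y⊆vy with InRowSpace? vx (Y i)
  ...   | yes Yi∈vx = InRowSpace-trans vx X vx⊆X Yi∈vx
  ...   | no  Yi∉vx = ⊥-elim (NP.<-irrefl P.refl (Indep∧RowSub⇒≤ (Y i ∷ₘ vx) vy (Indep-∷ vx (Y i) vx-indep Yi∉vx) Yi∷vx⊆vy))
    where
    Yi∷vx⊆vy : RowSub K (Y i ∷ₘ vx) vy
    Yi∷vx⊆vy zero    = Y⊆vy i
    Yi∷vx⊆vy (suc k) = InRowSpace-trans Y vy Y⊆vy (InRowSpace-trans X Y X⊆Y (vx⊆X k))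

  rank0⇒zero : ∀ {s n} (M : Matrix s n) → RankIs K M 0 → ∀ i j → M i j ≈ 0#
  rank0⇒zero M r i j with rank⇒basis M r
  ... | _ , _ , _ , M⊆0 = proj₂ (M⊆0 i) j

  zero⇒rank0 : ∀ {s n} (M : Matrix s n) → (∀ i j → M i j ≈ 0#) → RankIs K M 0
  zero⇒rank0 M M≈0 = basis⇒rank M ((λ ()) , (λ c h ()) , (λ ()) , λ i → (λ ()) , λ j → M≈0 i j)

  Indep⇒rank : ∀ {s n} (M : Matrix s n) → Indep K M → RankIs K M s
  Indep⇒rank M M-indep = basis⇒rank M (M , M-indep , RowSub-refl M , RowSub-refl M)

  identity : ∀ {n} → Matrix n n
  identity i j = δ i j

  RowSub-identity : ∀ {s n} (M : Matrix s n) → RowSub K M identity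
  RowSub-identity {s} {n} M i =
    M i , λ j → sym (trans (sum-cong {n} (λ k → trans (*-comm _ _) (*-congʳ (δ-sym k j)))) (sum-δ j (M i)))

  rank≤cols : ∀ {s n} (M : Matrix s n) {d} → RankIs K M d → d ≤ n
  rank≤cols M r with rank⇒basis M r
  ... | v , v-indep , _ , _ = Indep∧RowSub⇒≤ v identity v-indep (RowSub-identity v)

  rank≤rows : ∀ {s n} (M : Matrix s n) {d} → RankIs K M d → d ≤ s
  rank≤rows M ((v , v-indep , v⊆M) , _) = Indep∧RowSub⇒≤ v M v-indep v⊆M

  rank>0⇒nonzero-entry : ∀ {s n} (M : Matrix s n) {d} → RankIs K M (suc d) → ∃ λ i → ∃ λ j → ¬ M i j ≈ 0#
  rank>0⇒nonzero-entry {s} {n} M r with FinP.all? (λ i → FinP.all? (λ j → M i j ≟ 0#))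
  ... | yes M≈0 with rank-unique M r (zero⇒rank0 M M≈0)
  ...   | ()
  rank>0⇒nonzero-entry {s} {n} M r | no M≉0 with FinP.¬∀⟶∃¬ s _ (λ i → FinP.all? (λ j → M i j ≟ 0#)) M≉0
  ...   | i , Mi≉0 with FinP.¬∀⟶∃¬ n _ (λ j → M i j ≟ 0#) Mi≉0
  ...     | j , Mij≉0 = i , j , Mij≉0

  nonzero∧RowSub-row⇒rank1 : ∀ {s n} (M : Matrix s n) (w : Matrix 1 n) → RowSub K M w →
                               (∃ λ i → ∃ λ j → ¬ M i j ≈ 0#) → RankIs K M 1
  nonzero∧RowSub-row⇒rank1 M w M⊆w (i , j , Mij≉0) with rank-exists M | rank-exists w
  ... | zero , rM | _ = ⊥-elim (Mij≉0 (rank0⇒zero M rM i j))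
  ... | suc zero , rM | _ = rM
  ... | suc (suc _) , rM | _ , rw with NP.≤-trans (rank-mono M w M⊆w rM rw) (rank≤rows w rw)
  ...   | s≤s ()

  row : ∀ {n} → Vector Carrier n → Matrix 1 n
  row y _ = y

  rows : ∀ {n} → Vector Carrier n → Vector Carrier n → Matrix 2 n
  rows y z f0 = y
  rows y z f1 = z

  Indep-row : ∀ {n} (y : Vector Carrier n) j → ¬ y j ≈ 0# → Indep K (row y)
  Indep-row y j yj≉0 c c·y≈0 f0 = x*y≈0⇒y≈0 yj≉0 (trans (*-comm _ _) (trans (sym (+-identityʳ _)) (c·y≈0 j)))

  Indep-rows : ∀ {n} (y z : Vector Carrier n) j₁ j₂ → y j₁ ≈ 1# → z j₁ ≈ 0# → y j₂ ≈ 0# → z j₂ ≈ 1# → Indep K (rows y z)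
  Indep-rows y z j₁ j₂ y₁≈1 z₁≈0 y₂≈0 z₂≈1 c c·yz≈0 = coefficient≈0
    where
    evaluate : ∀ {a b} → a ≈ 1# → b ≈ 0# → c f0 * a + (c f1 * b + 0#) ≈ c f0
    evaluate a≈1 b≈0 =
      trans (+-cong (trans (*-congˡ a≈1) (*-identityʳ _)) (trans (+-identityʳ _) (trans (*-congˡ b≈0) (zeroʳ _)))) (+-identityʳ _)
    evaluate' : ∀ {a b} → a ≈ 0# → b ≈ 1# → c f0 * a + (c f1 * b + 0#) ≈ c f1
    evaluate' a≈0 b≈1 =
      trans (+-cong (trans (*-congˡ a≈0) (zeroʳ _)) (trans (+-identityʳ _) (trans (*-congˡ b≈1) (*-identityʳ _)))) (+-identityˡ _)
    coefficient≈0 : ∀ i → c i ≈ 0#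
    coefficient≈0 f0 = trans (sym (evaluate y₁≈1 z₁≈0)) (c·yz≈0 j₁)
    coefficient≈0 f1 = trans (sym (evaluate' y₂≈0 z₂≈1)) (c·yz≈0 j₂)

  rank1⇒columns-proportional : ∀ {s} (M : Matrix s 2) → RankIs K M 1 → ∀ {i₀} → ¬ M i₀ f0 ≈ 0# →
                               ∃ λ γ → ∀ i → M i f1 ≈ γ * M i f0
  rank1⇒columns-proportional M rM {i₀} Mi₀≉0 with rank⇒basis M rM
  ... | w , _ , _ , M⊆w = γ , proportional
    where
    coefficient : Fin _ → Carrier
    coefficient i = proj₁ (M⊆w i) f0
    M≈cw : ∀ i j → M i j ≈ coefficient i * w f0 j
    M≈cw i j = trans (proj₂ (M⊆w i) j) (+-identityʳ _)
    w₀≉0 : ¬ w f0 f0 ≈ 0#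
    w₀≉0 e = Mi₀≉0 (trans (M≈cw i₀ f0) (trans (*-congˡ e) (zeroʳ _)))
    γ : Carrier
    γ = w f0 f1 * inv (w f0 f0) w₀≉0
    proportional : ∀ i → M i f1 ≈ γ * M i f0
    proportional i = begin
      M i f1                                          ≈⟨ M≈cw i f1 ⟩
      coefficient i * w f0 f1                         ≈⟨ *-comm _ _ ⟩
      w f0 f1 * coefficient i                         ≈⟨ *-identityʳ _ ⟨
      w f0 f1 * coefficient i * 1#                    ≈⟨ *-congˡ (*-inverseˡ _ w₀≉0) ⟨
      w f0 f1 * coefficient i * (inv (w f0 f0) w₀≉0 * w f0 f0) ≈⟨ *-assoc _ _ _ ⟩
      w f0 f1 * (coefficient i * (inv (w f0 f0) w₀≉0 * w f0 f0)) ≈⟨ *-congˡ (x∙yz≈y∙xz _ _ _) ⟩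
      w f0 f1 * (inv (w f0 f0) w₀≉0 * (coefficient i * w f0 f0)) ≈⟨ *-assoc _ _ _ ⟨
      γ * (coefficient i * w f0 f0)                   ≈⟨ *-congˡ (M≈cw i f0) ⟨
      γ * M i f0                                      ∎

module Finite (K : Field) {N : ℕ} (hs : HasSize K N) where
  open FieldProperties K public
  open FiniteField K hs public
  open LinearAlgebra K hs public

-- The rank function of U₁,₂ ⊕ U₁,₂

-- The rank of V in U₁,₂ ⊕ U₁,₂, given d = dim V and the ranks rᵢ of the two projections of V.
rank⊕ : ℕ → ℕ → ℕ → ℕ
rank⊕ d r₁ r₂ = (1 ⊓ r₁ ℕ.+ 1 ⊓ r₂) ⊓ d

rank⊕-cases : ∀ d r₁ r₂ → rank⊕ d r₁ r₂ ≡ d ⊎ (rank⊕ d r₁ r₂ ≡ 1 ⊓ r₁ ℕ.+ 1 ⊓ r₂ × 1 ⊓ r₁ ℕ.+ 1 ⊓ r₂ < d)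
rank⊕-cases d r₁ r₂ with d NP.≤? 1 ⊓ r₁ ℕ.+ 1 ⊓ r₂
... | yes d≤a = inj₁ (NP.m≥n⇒m⊓n≡n d≤a)
... | no  d≰a = inj₂ (NP.m≤n⇒m⊓n≡m (NP.<⇒≤ (NP.≰⇒> d≰a)) , NP.≰⇒> d≰a)

rank⊕-r₂≡0 : ∀ {d r} → d ≤ r ℕ.+ 0 → rank⊕ d r 0 ≡ 1 ⊓ d
rank⊕-r₂≡0 {zero}  {zero}  _ = P.refl
rank⊕-r₂≡0 {zero}  {suc r} _ = P.refl
rank⊕-r₂≡0 {suc d} {zero}  ()
rank⊕-r₂≡0 {suc d} {suc r} _ = P.refl

rank⊕-r₁≡0 : ∀ {d r} → d ≤ 0 ℕ.+ r → rank⊕ d 0 r ≡ 1 ⊓ d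
rank⊕-r₁≡0 {zero}  {zero}  _ = P.refl
rank⊕-r₁≡0 {zero}  {suc r} _ = P.refl
rank⊕-r₁≡0 {suc d} {zero}  ()
rank⊕-r₁≡0 {suc d} {suc r} _ = P.refl

-- rank⊕ − dim V ≤ ρ₁'(X) + ρ₂'(X) − dim X for a subspace X of V described by dX, e₁, e₂; the one
-- configuration where this fails, X = V with both projections of V nonzero, is excluded.
RankLowerBound : ℕ → ℕ → ℕ → ℕ → ℕ → ℕ → Set
RankLowerBound d r₁ r₂ dX e₁ e₂ =
  dX ≤ d → dX ≤ e₁ ℕ.+ e₂ → ¬ (d ≡ dX × 1 ≤ r₁ × 1 ≤ r₂ × 1 ⊓ e₁ ℕ.+ 1 ⊓ e₂ < 2) →
  rank⊕ d r₁ r₂ ℕ.+ dX ≤ (1 ⊓ e₁ ℕ.+ 1 ⊓ e₂) ℕ.+ d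

rankLowerBound? : ∀ d r₁ r₂ dX e₁ e₂ → Dec (RankLowerBound d r₁ r₂ dX e₁ e₂)
rankLowerBound? d r₁ r₂ dX e₁ e₂ =
  dX NP.≤? d →-dec dX NP.≤? e₁ ℕ.+ e₂ →-dec
  ¬? (d NP.≟ dX ×-dec 1 NP.≤? r₁ ×-dec 1 NP.≤? r₂ ×-dec suc (1 ⊓ e₁ ℕ.+ 1 ⊓ e₂) NP.≤? 2) →-dec
  rank⊕ d r₁ r₂ ℕ.+ dX NP.≤? (1 ⊓ e₁ ℕ.+ 1 ⊓ e₂) ℕ.+ d

-- Dimensions are at most 4 and projection ranks at most 2, so finitely many cases are checked.
rank-lower-bound : ∀ {d} → d < 5 → ∀ {r₁} → r₁ < 3 → ∀ {r₂} → r₂ < 3 →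
                   ∀ {dX} → dX < 5 → ∀ {e₁} → e₁ < 3 → ∀ {e₂} → e₂ < 3 → RankLowerBound d r₁ r₂ dX e₁ e₂
rank-lower-bound = toWitness {a? = cases?} _
  where
  cases? : Dec (∀ {d} → d < 5 → ∀ {r₁} → r₁ < 3 → ∀ {r₂} → r₂ < 3 →
                 ∀ {dX} → dX < 5 → ∀ {e₁} → e₁ < 3 → ∀ {e₂} → e₂ < 3 → RankLowerBound d r₁ r₂ dX e₁ e₂)
  cases? = NP.allUpTo? (λ d → NP.allUpTo? (λ r₁ → NP.allUpTo? (λ r₂ → NP.allUpTo? (λ dX →
           NP.allUpTo? (λ e₁ → NP.allUpTo? (λ e₂ → rankLowerBound? d r₁ r₂ dX e₁ e₂) 3) 3) 5) 3) 3) 5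

+a-+b≤+c-+d : ∀ a b c d → a ℕ.+ d ≤ c ℕ.+ b → (+ a ℤ.- + b) ℤ.≤ (+ c ℤ.- + d)
+a-+b≤+c-+d a b c d h rewrite ZP.m-n≡m⊖n a b | ZP.m-n≡m⊖n c d =
  ZP.≤-trans (ZP.≤-reflexive (P.sym (ZP.+-cancelˡ-⊖ d a b)))
   (ZP.≤-trans (ZP.⊖-monoˡ-≤ (d ℕ.+ b) (P.subst (_≤ c ℕ.+ b) (NP.+-comm a d) h))
     (ZP.≤-reflexive (P.trans (P.cong₂ ℤ._⊖_ (NP.+-comm c b) (NP.+-comm d b)) (ZP.+-cancelˡ-⊖ b c d))))

+a+[+b-+a]≡+b : ∀ a b → + a ℤ.+ (+ b ℤ.- + a) ≡ + b
+a+[+b-+a]≡+b a b = begin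
  + a ℤ.+ (+ b ℤ.- + a) ≡⟨ ZP.+-assoc (+ a) (+ b) (ℤ.- + a) ⟨
  + a ℤ.+ + b ℤ.- + a   ≡⟨ P.cong (λ z → z ℤ.- + a) (ZP.+-comm (+ a) (+ b)) ⟩
  + b ℤ.+ + a ℤ.- + a   ≡⟨ ZP.+-assoc (+ b) (+ a) (ℤ.- + a) ⟩
  + b ℤ.+ (+ a ℤ.- + a) ≡⟨ P.cong (λ z → + b ℤ.+ z) (ZP.+-inverseʳ (+ a)) ⟩
  + b ℤ.+ + 0           ≡⟨ ZP.+-identityʳ (+ b) ⟩
  + b                   ∎
  where open P.≡-Reasoning

data SplitView (n₁ n₂ : ℕ) : Fin (n₁ ℕ.+ n₂) → Set where
  inl : ∀ i → SplitView n₁ n₂ (i ↑ˡ n₂)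
  inr : ∀ i → SplitView n₁ n₂ (n₁ ↑ʳ i)

splitView : ∀ n₁ n₂ (j : Fin (n₁ ℕ.+ n₂)) → SplitView n₁ n₂ j
splitView zero     n₂ j       = inr j
splitView (suc n₁) n₂ zero    = inl zero
splitView (suc n₁) n₂ (suc j) with splitView n₁ n₂ j
... | inl i = inl (suc i)
... | inr i = inr i

module DirectSumRank (F : Field) {N : ℕ} (hs : HasSize F N) where
  open Finite F hs
  open import Relation.Binary.Reasoning.Setoid setoid

  zeros : ∀ {n} → Vector Carrier n
  zeros _ = 0#

  ≋-split : ∀ {n₁ n₂} {u v : Vector Carrier (n₁ ℕ.+ n₂)} →
            (∀ j → u (j ↑ˡ n₂) ≈ v (j ↑ˡ n₂)) → (∀ j → u (n₁ ↑ʳ j) ≈ v (n₁ ↑ʳ j)) → u ≋ v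
  ≋-split {n₁} {n₂} left right j with splitView n₁ n₂ j
  ... | inl j₁ = left j₁
  ... | inr j₂ = right j₂

  blockDiag : ∀ {r₁ r₂ n₁ n₂} → Matrix r₁ n₁ → Matrix r₂ n₂ → Matrix (r₁ ℕ.+ r₂) (n₁ ℕ.+ n₂)
  blockDiag B₁ B₂ = (λ k → B₁ k ++ zeros) ++ (λ k → zeros ++ B₂ k)

  lincomb-blockDiag : ∀ {r₁ r₂ n₁ n₂} (B₁ : Matrix r₁ n₁) (B₂ : Matrix r₂ n₂) c₁ c₂ →
                      lincomb (c₁ ++ c₂) (blockDiag B₁ B₂) ≋ (lincomb c₁ B₁ ++ lincomb c₂ B₂)
  lincomb-blockDiag {r₁} {r₂} {n₁} {n₂} B₁ B₂ c₁ c₂ = ≋-split left right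
    where
    C : Matrix (r₁ ℕ.+ r₂) (n₁ ℕ.+ n₂)
    C = blockDiag B₁ B₂
    row₁ : ∀ k j → C (k ↑ˡ r₂) j ≈ (B₁ k ++ zeros) j
    row₁ k j = reflexive (P.cong (λ row → row j) (lookup-++ˡ (λ k → B₁ k ++ zeros) (λ k → zeros ++ B₂ k) k))
    row₂ : ∀ k j → C (r₁ ↑ʳ k) j ≈ (zeros ++ B₂ k) j
    row₂ k j = reflexive (P.cong (λ row → row j) (lookup-++ʳ (λ k → B₁ k ++ zeros) (λ k → zeros ++ B₂ k) k))
    split : ∀ j → lincomb (c₁ ++ c₂) C j ≈ sum (λ k → c₁ k * (B₁ k ++ zeros) j) + sum (λ k → c₂ k * (zeros ++ B₂ k) j)
    split j = trans (sum-split {r₁} {r₂} _)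
      (+-cong (sum-cong (λ k → *-cong (reflexive (lookup-++ˡ c₁ c₂ k)) (row₁ k j)))
              (sum-cong (λ k → *-cong (reflexive (lookup-++ʳ c₁ c₂ k)) (row₂ k j))))
    left : ∀ j → lincomb (c₁ ++ c₂) C (j ↑ˡ n₂) ≈ (lincomb c₁ B₁ ++ lincomb c₂ B₂) (j ↑ˡ n₂)
    left j = begin
      lincomb (c₁ ++ c₂) C (j ↑ˡ n₂)
        ≈⟨ split (j ↑ˡ n₂) ⟩
      sum (λ k → c₁ k * (B₁ k ++ zeros) (j ↑ˡ n₂)) + sum (λ k → c₂ k * (zeros ++ B₂ k) (j ↑ˡ n₂))
        ≈⟨ +-cong (sum-cong (λ k → *-congˡ (reflexive (lookup-++ˡ (B₁ k) zeros j))))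
                  (sum-zero _ (λ k → trans (*-congˡ (reflexive (lookup-++ˡ zeros (B₂ k) j))) (zeroʳ _))) ⟩
      lincomb c₁ B₁ j + 0#
        ≈⟨ +-identityʳ _ ⟩
      lincomb c₁ B₁ j
        ≡⟨ lookup-++ˡ (lincomb c₁ B₁) (lincomb c₂ B₂) j ⟨
      (lincomb c₁ B₁ ++ lincomb c₂ B₂) (j ↑ˡ n₂) ∎
    right : ∀ j → lincomb (c₁ ++ c₂) C (n₁ ↑ʳ j) ≈ (lincomb c₁ B₁ ++ lincomb c₂ B₂) (n₁ ↑ʳ j)
    right j = begin
      lincomb (c₁ ++ c₂) C (n₁ ↑ʳ j)
        ≈⟨ split (n₁ ↑ʳ j) ⟩
      sum (λ k → c₁ k * (B₁ k ++ zeros) (n₁ ↑ʳ j)) + sum (λ k → c₂ k * (zeros ++ B₂ k) (n₁ ↑ʳ j))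
        ≈⟨ +-cong (sum-zero _ (λ k → trans (*-congˡ (reflexive (lookup-++ʳ (B₁ k) zeros j))) (zeroʳ _)))
                  (sum-cong (λ k → *-congˡ (reflexive (lookup-++ʳ {m = n₁} zeros (B₂ k) j)))) ⟩
      0# + lincomb c₂ B₂ j
        ≈⟨ +-identityˡ _ ⟩
      lincomb c₂ B₂ j
        ≡⟨ lookup-++ʳ (lincomb c₁ B₁) (lincomb c₂ B₂) j ⟨
      (lincomb c₁ B₁ ++ lincomb c₂ B₂) (n₁ ↑ʳ j) ∎

  rank≤rank-π₁+rank-π₂ : ∀ {s n₁ n₂} (X : Matrix s (n₁ ℕ.+ n₂)) {d r₁ r₂} → RankIs F X d →
                          RankIs F (π₁ F {n₁} {n₂} X) r₁ → RankIs F (π₂ F {n₁} {n₂} X) r₂ → d ≤ r₁ ℕ.+ r₂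
  rank≤rank-π₁+rank-π₂ {s} {n₁} {n₂} X {d} {r₁} {r₂} rX rX₁ rX₂ with rank⇒basis _ rX₁ | rank⇒basis _ rX₂ | rank⇒basis X rX
  ... | B₁ , _ , _ , X₁⊆B₁ | B₂ , _ , _ , X₂⊆B₂ | V , V-indep , V⊆X , _ =
    Indep∧RowSub⇒≤ V (blockDiag B₁ B₂) V-indep (RowSub-trans V X _ V⊆X X⊆B)
    where
    X⊆B : RowSub F X (blockDiag B₁ B₂)
    X⊆B i = (c₁ ++ c₂) , λ j → trans (Xi≋ j) (sym (lincomb-blockDiag B₁ B₂ c₁ c₂ j))
      where
      c₁ : Vector Carrier r₁
      c₁ = proj₁ (X₁⊆B₁ i)
      c₂ : Vector Carrier r₂
      c₂ = proj₁ (X₂⊆B₂ i)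
      Xi≋ : X i ≋ (lincomb c₁ B₁ ++ lincomb c₂ B₂)
      Xi≋ = ≋-split (λ j → trans (proj₂ (X₁⊆B₁ i) j) (reflexive (P.sym (lookup-++ˡ (lincomb c₁ B₁) (lincomb c₂ B₂) j))))
                    (λ j → trans (proj₂ (X₂⊆B₂ i) j) (reflexive (P.sym (lookup-++ʳ (lincomb c₁ B₁) (lincomb c₂ B₂) j))))

  π₁-zero-RowSub : ∀ {s t n₁ n₂} (Y : Matrix s (n₁ ℕ.+ n₂)) (X : Matrix t (n₁ ℕ.+ n₂)) → RowSub F Y X →
                   (∀ i j → π₁ F X i j ≈ 0#) → ∀ i j → π₁ F Y i j ≈ 0#
  π₁-zero-RowSub {t = t} {n₂ = n₂} Y X Y⊆X X₁≈0 i j =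
    trans (proj₂ (Y⊆X i) (j ↑ˡ n₂)) (sum-zero {t} _ (λ k → trans (*-congˡ (X₁≈0 k j)) (zeroʳ _)))

  π₂-zero-RowSub : ∀ {s t n₁ n₂} (Y : Matrix s (n₁ ℕ.+ n₂)) (X : Matrix t (n₁ ℕ.+ n₂)) → RowSub F Y X →
                   (∀ i j → π₂ F X i j ≈ 0#) → ∀ i j → π₂ F Y i j ≈ 0#
  π₂-zero-RowSub {t = t} {n₁ = n₁} Y X Y⊆X X₂≈0 i j =
    trans (proj₂ (Y⊆X i) (n₁ ↑ʳ j)) (sum-zero {t} _ (λ k → trans (*-congˡ (X₂≈0 k j)) (zeroʳ _)))

  proportional : ∀ {n₁ n₂} (y z : Vector Carrier (n₁ ℕ.+ n₂)) a₀ b₀ → ¬ y (a₀ ↑ˡ n₂) ≈ 0# → ¬ y (n₁ ↑ʳ b₀) ≈ 0# →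
                 (∀ a b → z (a ↑ˡ n₂) * y (n₁ ↑ʳ b) ≈ y (a ↑ˡ n₂) * z (n₁ ↑ʳ b)) → ∃ λ t → ∀ k → z k ≈ t * y k
  proportional {n₁} {n₂} y z a₀ b₀ ya₀≉0 yb₀≉0 cross = t , ≋-split left right
    where
    t = z (n₁ ↑ʳ b₀) * inv (y (n₁ ↑ʳ b₀)) yb₀≉0
    left : ∀ a → z (a ↑ˡ n₂) ≈ t * y (a ↑ˡ n₂)
    left a = begin
      z (a ↑ˡ n₂)                                                 ≈⟨ *-identityʳ _ ⟨
      z (a ↑ˡ n₂) * 1#                                            ≈⟨ *-congˡ (*-inverseʳ _ yb₀≉0) ⟨
      z (a ↑ˡ n₂) * (y (n₁ ↑ʳ b₀) * inv (y (n₁ ↑ʳ b₀)) yb₀≉0)     ≈⟨ *-assoc _ _ _ ⟨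
      (z (a ↑ˡ n₂) * y (n₁ ↑ʳ b₀)) * inv (y (n₁ ↑ʳ b₀)) yb₀≉0     ≈⟨ *-congʳ (cross a b₀) ⟩
      (y (a ↑ˡ n₂) * z (n₁ ↑ʳ b₀)) * inv (y (n₁ ↑ʳ b₀)) yb₀≉0     ≈⟨ *-assoc _ _ _ ⟩
      y (a ↑ˡ n₂) * t                                             ≈⟨ *-comm _ _ ⟩
      t * y (a ↑ˡ n₂)                                             ∎
    right : ∀ b → z (n₁ ↑ʳ b) ≈ t * y (n₁ ↑ʳ b)
    right b = *-cancelˡ (y (a₀ ↑ˡ n₂)) ya₀≉0 (begin
      y (a₀ ↑ˡ n₂) * z (n₁ ↑ʳ b)         ≈⟨ cross a₀ b ⟨
      z (a₀ ↑ˡ n₂) * y (n₁ ↑ʳ b)         ≈⟨ *-congʳ (trans (left a₀) (*-comm _ _)) ⟩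
      (y (a₀ ↑ˡ n₂) * t) * y (n₁ ↑ʳ b)   ≈⟨ *-assoc _ _ _ ⟩
      y (a₀ ↑ˡ n₂) * (t * y (n₁ ↑ʳ b))   ∎)

  U⊕U : RankRel F 4
  U⊕U = DirectSum F {2} {2} (Uniform F 1 2) (Uniform F 1 2)

  πₗ πᵣ : ∀ {s} → Matrix s 4 → Matrix s 2
  πₗ = π₁ F {2} {2}
  πᵣ = π₂ F {2} {2}

  InX₀ : ∀ {t} → Matrix t 4 → Set
  InX₀ X = RankIs F X 0 ⊎ (∃ λ a₁ → ∃ λ a₂ → ∃ λ dX →
    Uniform F 1 2 (πₗ X) a₁ × Uniform F 1 2 (πᵣ X) a₂ × RankIs F X dX × a₁ ℕ.+ a₂ < dX)

  Value : ∀ {t} → Matrix t 4 → ℤ → Set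
  Value X ν = ∃ λ a₁ → ∃ λ a₂ → ∃ λ dX →
    Uniform F 1 2 (πₗ X) a₁ × Uniform F 1 2 (πᵣ X) a₂ × RankIs F X dX × ν ≡ (+ a₁ ℤ.+ + a₂) ℤ.- + dX

  minValue : ℕ → ℕ → ℕ → ℤ
  minValue d r₁ r₂ = + rank⊕ d r₁ r₂ ℤ.- + d

  rank<1+cols : ∀ {s n} (M : Matrix s n) {d} → RankIs F M d → d < suc n
  rank<1+cols M r = s≤s (rank≤cols M r)

  ∅ : Matrix 0 4
  ∅ ()

  minValue-attained : ∀ {s} (Y : Matrix s 4) {d r₁ r₂} → RankIs F Y d → RankIs F (πₗ Y) r₁ → RankIs F (πᵣ Y) r₂ →
                      ∃ λ t → ∃ λ (X : Matrix t 4) → RowSub F X Y × InX₀ X × Value X (minValue d r₁ r₂)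
  minValue-attained {s} Y {d} {r₁} {r₂} rY rY₁ rY₂ with rank⊕-cases d r₁ r₂
  ... | inj₁ ρ≡d = 0 , ∅ , (λ ()) , inj₁ r∅ , 0 , 0 , 0 , (0 , r∅₁ , P.refl) , (0 , r∅₂ , P.refl) , r∅ ,
        P.trans (P.cong (λ z → + z ℤ.- + d) ρ≡d) (ZP.+-inverseʳ (+ d))
    where
    r∅ : RankIs F ∅ 0
    r∅ = zero⇒rank0 ∅ (λ ())
    r∅₁ : RankIs F (πₗ ∅) 0
    r∅₁ = zero⇒rank0 (πₗ ∅) (λ ())
    r∅₂ : RankIs F (πᵣ ∅) 0
    r∅₂ = zero⇒rank0 (πᵣ ∅) (λ ())
  ... | inj₂ (ρ≡a , a<d) = s , Y , RowSub-refl Y ,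
        inj₂ (1 ⊓ r₁ , 1 ⊓ r₂ , d , (r₁ , rY₁ , P.refl) , (r₂ , rY₂ , P.refl) , rY , a<d) ,
        1 ⊓ r₁ , 1 ⊓ r₂ , d , (r₁ , rY₁ , P.refl) , (r₂ , rY₂ , P.refl) , rY , P.cong (λ z → + z ℤ.- + d) ρ≡a

  -- A subspace X of Y of the same dimension is Y itself, so a zero projection of X is one of Y.
  spanning-subspace : ∀ {s t} (Y : Matrix s 4) (X : Matrix t 4) {d r₁ r₂ e₁ e₂} →
    RankIs F Y d → RankIs F (πₗ Y) r₁ → RankIs F (πᵣ Y) r₂ → RowSub F X Y → RankIs F X d →
    RankIs F (πₗ X) e₁ → RankIs F (πᵣ X) e₂ → 1 ≤ r₁ → 1 ≤ r₂ → ¬ 1 ⊓ e₁ ℕ.+ 1 ⊓ e₂ < 2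
  spanning-subspace Y X {e₁ = zero} rY rY₁ rY₂ X⊆Y rX rX₁ rX₂ 1≤r₁ 1≤r₂ _ =
    NP.<-irrefl (P.sym (rank-unique (πₗ Y) rY₁ (zero⇒rank0 (πₗ Y) Y₁≈0))) 1≤r₁
    where
    Y₁≈0 : ∀ i j → πₗ Y i j ≈ 0#
    Y₁≈0 = π₁-zero-RowSub Y X (RowSub∧rank≡⇒RowSub X Y X⊆Y rX rY) (rank0⇒zero (πₗ X) rX₁)
  spanning-subspace Y X {e₁ = suc _} {e₂ = zero} rY rY₁ rY₂ X⊆Y rX rX₁ rX₂ 1≤r₁ 1≤r₂ _ =
    NP.<-irrefl (P.sym (rank-unique (πᵣ Y) rY₂ (zero⇒rank0 (πᵣ Y) Y₂≈0))) 1≤r₂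
    where
    Y₂≈0 : ∀ i j → πᵣ Y i j ≈ 0#
    Y₂≈0 = π₂-zero-RowSub Y X (RowSub∧rank≡⇒RowSub X Y X⊆Y rX rY) (rank0⇒zero (πᵣ X) rX₂)
  spanning-subspace Y X {e₁ = suc _} {e₂ = suc _} _ _ _ _ _ _ _ _ _ (s≤s (s≤s ()))

  minValue-lower : ∀ {s} (Y : Matrix s 4) {d r₁ r₂} → RankIs F Y d → RankIs F (πₗ Y) r₁ → RankIs F (πᵣ Y) r₂ →
                   ∀ {t} (X : Matrix t 4) → RowSub F X Y → ∀ ν → Value X ν → minValue d r₁ r₂ ℤ.≤ ν
  minValue-lower Y {d} {r₁} {r₂} rY rY₁ rY₂ X X⊆Y ν (_ , _ , dX , (e₁ , rX₁ , P.refl) , (e₂ , rX₂ , P.refl) , rX , P.refl) =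
    +a-+b≤+c-+d (rank⊕ d r₁ r₂) d (1 ⊓ e₁ ℕ.+ 1 ⊓ e₂) dX
      (rank-lower-bound (rank<1+cols Y rY) (rank<1+cols _ rY₁) (rank<1+cols _ rY₂)
                        (rank<1+cols X rX) (rank<1+cols _ rX₁) (rank<1+cols _ rX₂)
                        (rank-mono X Y X⊆Y rX rY) (rank≤rank-π₁+rank-π₂ X rX rX₁ rX₂) not-spanning)
    where
    not-spanning : ¬ (d ≡ dX × 1 ≤ r₁ × 1 ≤ r₂ × 1 ⊓ e₁ ℕ.+ 1 ⊓ e₂ < 2)
    not-spanning (P.refl , 1≤r₁ , 1≤r₂ , a<2) = spanning-subspace Y X rY rY₁ rY₂ X⊆Y rX rX₁ rX₂ 1≤r₁ 1≤r₂ a<2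

  U⊕U-rank : ∀ {s} (Y : Matrix s 4) {d r₁ r₂} → RankIs F Y d → RankIs F (πₗ Y) r₁ → RankIs F (πᵣ Y) r₂ →
             ∀ r → U⊕U Y r ⇔ r ≡ rank⊕ d r₁ r₂
  U⊕U-rank Y {d} {r₁} {r₂} rY rY₁ rY₂ r = mk⇔ to from
    where
    to : U⊕U Y r → r ≡ rank⊕ d r₁ r₂
    to (d' , rY' , μ , ((_ , X , X⊆Y , _ , value) , lower) , r≡d+μ) with minValue-attained Y rY rY₁ rY₂ | rank-unique Y rY' rY
    ... | _ , X* , X*⊆Y , X*∈X₀ , value* | P.refl =
      ZP.+-injective (P.trans r≡d+μ (P.trans (P.cong (λ z → + d ℤ.+ z) μ≡) (+a+[+b-+a]≡+b d (rank⊕ d r₁ r₂))))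
      where
      μ≡ : μ ≡ minValue d r₁ r₂
      μ≡ = ZP.≤-antisym (lower X* X*⊆Y X*∈X₀ _ value*) (minValue-lower Y rY rY₁ rY₂ X X⊆Y μ value)
    from : r ≡ rank⊕ d r₁ r₂ → U⊕U Y r
    from P.refl = d , rY , minValue d r₁ r₂ ,
      (minValue-attained Y rY rY₁ rY₂ , (λ X X⊆Y _ ν value → minValue-lower Y rY rY₁ rY₂ X X⊆Y ν value)) ,
      P.sym (+a+[+b-+a]≡+b d (rank⊕ d r₁ r₂))

-- Elements of the extension field

module ExtensionProperties (F L : Field) (E : Extension F L) {NF NL : ℕ} (hsF : HasSize F NF) (hsL : HasSize L NL) where
  module 𝔽 = Finite F hsF
  open Finite L hsL
  open Extension E public
  open IsRingHomomorphism isHom public using (+-homo; *-homo; 0#-homo; 1#-homo; -‿homo; ⟦⟧-cong)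
  open import Relation.Binary.Reasoning.Setoid setoid

  ι-≉0 : ∀ {a} → ¬ a 𝔽.≈ 𝔽.0# → ¬ ι a ≈ 0#
  ι-≉0 {a} a≉0 e = 0#≉1# (begin
    0#                       ≈⟨ zeroˡ _ ⟨
    0# * ι (𝔽.inv a a≉0)     ≈⟨ *-congʳ e ⟨
    ι a * ι (𝔽.inv a a≉0)    ≈⟨ *-homo _ _ ⟨
    ι (a 𝔽.* 𝔽.inv a a≉0)   ≈⟨ ⟦⟧-cong (𝔽.*-inverseʳ a a≉0) ⟩
    ι 𝔽.1#                   ≈⟨ 1#-homo ⟩
    1#                       ∎)

  ι≈0⇒≈0 : ∀ {a} → ι a ≈ 0# → a 𝔽.≈ 𝔽.0#
  ι≈0⇒≈0 {a} e with a 𝔽.≟ 𝔽.0#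
  ... | yes a≈0 = a≈0
  ... | no  a≉0 = ⊥-elim (ι-≉0 a≉0 e)

  ι-sub : ∀ a b → ι (a 𝔽.- b) ≈ ι a - ι b
  ι-sub a b = trans (+-homo _ _) (+-congˡ (-‿homo b))

  *ι0 : ∀ x → x * ι 𝔽.0# ≈ 0#
  *ι0 x = trans (*-congˡ 0#-homo) (zeroʳ x)

  *ι1 : ∀ x → x * ι 𝔽.1# ≈ x
  *ι1 x = trans (*-congˡ 1#-homo) (*-identityʳ x)

  ι-1 : ι (𝔽.- 𝔽.1#) ≈ - 1#
  ι-1 = trans (-‿homo _) (-‿cong 1#-homo)

  NotInBase : Carrier → Set
  NotInBase α = ∀ a → ¬ α ≈ ι a

  ∃-NotInBase : NF < NL → ∃ NotInBase
  ∃-NotInBase NF<NL with injects-into-smaller⇒∃¬ {Bad = λ x → ∃ λ i → x ≈ ι (𝔽.element i)}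
                           (λ x → FinP.any? (λ i → x ≟ ι (𝔽.element i))) NF<NL (λ x → proj₁)
                           (λ { {bx = i , x≈ιi} {by = .i , y≈ιi} P.refl → trans x≈ιi (sym y≈ιi) })
  ... | α , α∉ = α , λ a α≈ιa → α∉ (𝔽.index a , trans α≈ιa (⟦⟧-cong (𝔽.element-index a)))

  independent⇒NF^r≤NL : ∀ {r} (xs : Vector Carrier r) →
                         (∀ c → sum (λ l → ι (c l) * xs l) ≈ 0# → ∀ l → c l 𝔽.≈ 𝔽.0#) → NF ^ r ≤ NL
  independent⇒NF^r≤NL {r} xs independent with NF ^ r NP.≤? NL
  ... | yes NF^r≤NL = NF^r≤NL
  ... | no  NF^r≰NL = ⊥-elim (𝔽.vector-pigeonhole {r} (λ i → index (combination (𝔽.vector i))) (NP.≰⇒> NF^r≰NL) injective)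
    where
    combination : Vector 𝔽.Carrier r → Carrier
    combination c = sum (λ l → ι (c l) * xs l)
    xs-column : Matrix r 1
    xs-column l _ = xs l
    injective : ∀ {i j} → index (combination (𝔽.vector i)) ≡ index (combination (𝔽.vector j)) → 𝔽.vector {r} i 𝔽.≋ 𝔽.vector j
    injective {i} {j} e = λ l → 𝔽.x∙y⁻¹≈ε⇒x≈y _ _ (independent (λ l → 𝔽.vector i l 𝔽.- 𝔽.vector j l) difference≈0 l)
      where
      same : combination (𝔽.vector i) ≈ combination (𝔽.vector j)
      same = trans (element-index _) (trans (reflexive (P.cong element e)) (sym (element-index _)))
      difference≈0 : combination (λ l → 𝔽.vector i l 𝔽.- 𝔽.vector j l) ≈ 0#
      difference≈0 = trans (sum-cong {r} (λ l → *-congʳ (ι-sub _ _)))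
                       (trans (lincomb-sub (λ l → ι (𝔽.vector i l)) (λ l → ι (𝔽.vector j l)) xs-column f0) (x≈y⇒x∙y⁻¹≈ε same))

  module Span (α : Carrier) (α∉F : NotInBase α) where

    φ : 𝔽.Carrier → 𝔽.Carrier → Carrier
    φ a₀ a₁ = ι a₀ + α * ι a₁

    φ-cong : ∀ {a₀ a₁ b₀ b₁} → a₀ 𝔽.≈ b₀ → a₁ 𝔽.≈ b₁ → φ a₀ a₁ ≈ φ b₀ b₁
    φ-cong e₀ e₁ = +-cong (⟦⟧-cong e₀) (*-congˡ (⟦⟧-cong e₁))

    φ-zero : ∀ {a₀ a₁} → a₀ 𝔽.≈ 𝔽.0# → a₁ 𝔽.≈ 𝔽.0# → φ a₀ a₁ ≈ 0#
    φ-zero a₀≈0 a₁≈0 = trans (φ-cong a₀≈0 a₁≈0) (trans (+-cong 0#-homo (*ι0 α)) (+-identityˡ _))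

    φ≈0⇒≈0 : ∀ a₀ a₁ → φ a₀ a₁ ≈ 0# → a₀ 𝔽.≈ 𝔽.0# × a₁ 𝔽.≈ 𝔽.0#
    φ≈0⇒≈0 a₀ a₁ e with a₁ 𝔽.≟ 𝔽.0#
    ... | yes a₁≈0 = ι≈0⇒≈0 (trans (sym (+-identityʳ _)) (trans (+-congˡ (sym (trans (*-congˡ (⟦⟧-cong a₁≈0)) (*ι0 α)))) e)) , a₁≈0
    ... | no  a₁≉0 = ⊥-elim (α∉F (𝔽.- a₀ 𝔽.* 𝔽.inv a₁ a₁≉0) (begin
        α                               ≈⟨ *-identityʳ α ⟨
        α * 1#                          ≈⟨ *-congˡ (trans (sym 1#-homo) (⟦⟧-cong (𝔽.sym (𝔽.*-inverseʳ a₁ a₁≉0)))) ⟩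
        α * ι (a₁ 𝔽.* 𝔽.inv a₁ a₁≉0)    ≈⟨ *-congˡ (*-homo _ _) ⟩
        α * (ι a₁ * ι (𝔽.inv a₁ a₁≉0))  ≈⟨ *-assoc _ _ _ ⟨
        (α * ι a₁) * ι (𝔽.inv a₁ a₁≉0)  ≈⟨ *-congʳ (trans (inverseˡ-unique _ _ (trans (+-comm _ _) e)) (sym (-‿homo a₀))) ⟩
        ι (𝔽.- a₀) * ι (𝔽.inv a₁ a₁≉0)  ≈⟨ *-homo _ _ ⟨
        ι (𝔽.- a₀ 𝔽.* 𝔽.inv a₁ a₁≉0)    ∎))

    φ≉0⇒≉0 : ∀ {a₀ a₁} → ¬ φ a₀ a₁ ≈ 0# → ¬ a₀ 𝔽.≈ 𝔽.0# ⊎ ¬ a₁ 𝔽.≈ 𝔽.0#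
    φ≉0⇒≉0 {a₀} {a₁} φ≉0 with a₀ 𝔽.≟ 𝔽.0# | a₁ 𝔽.≟ 𝔽.0#
    ... | no  a₀≉0 | _         = inj₁ a₀≉0
    ... | yes a₀≈0 | no  a₁≉0 = inj₂ a₁≉0
    ... | yes a₀≈0 | yes a₁≈0 = ⊥-elim (φ≉0 (φ-zero a₀≈0 a₁≈0))

    ι*φ : ∀ c a₀ a₁ → ι c * φ a₀ a₁ ≈ φ (c 𝔽.* a₀) (c 𝔽.* a₁)
    ι*φ c a₀ a₁ = begin
      ι c * (ι a₀ + α * ι a₁)        ≈⟨ distribˡ _ _ _ ⟩
      ι c * ι a₀ + ι c * (α * ι a₁)  ≈⟨ +-cong (sym (*-homo _ _)) (x∙yz≈y∙xz _ _ _) ⟩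
      ι (c 𝔽.* a₀) + α * (ι c * ι a₁) ≈⟨ +-congˡ (*-congˡ (sym (*-homo _ _))) ⟩
      ι (c 𝔽.* a₀) + α * ι (c 𝔽.* a₁) ∎

    φ-sub : ∀ a₀ a₁ b₀ b₁ → φ (a₀ 𝔽.- b₀) (a₁ 𝔽.- b₁) ≈ φ a₀ a₁ - φ b₀ b₁
    φ-sub a₀ a₁ b₀ b₁ = begin
      ι (a₀ 𝔽.- b₀) + α * ι (a₁ 𝔽.- b₁)         ≈⟨ +-cong (ι-sub a₀ b₀) (*-congˡ (ι-sub a₁ b₁)) ⟩
      (ι a₀ - ι b₀) + α * (ι a₁ - ι b₁)         ≈⟨ +-congˡ (x[y-z]≈xy-xz _ _ _) ⟩
      (ι a₀ - ι b₀) + (α * ι a₁ - α * ι b₁)     ≈⟨ [a-b]+[c-d]≈[a+c]-[b+d] _ _ _ _ ⟩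
      φ a₀ a₁ - φ b₀ b₁                         ∎

    φ-neg : ∀ a₀ a₁ → φ (𝔽.- a₀) (𝔽.- a₁) ≈ - φ a₀ a₁
    φ-neg a₀ a₁ = trans (+-cong (-‿homo a₀) (trans (*-congˡ (-‿homo a₁)) (sym (-‿distribʳ-* _ _)))) (⁻¹-∙-comm _ _)

    φ-*-expand : ∀ γ x₀ x₁ y₀ y₁ → φ x₀ x₁ * (ι y₀ + γ * ι y₁) ≈
                 φ (x₀ 𝔽.* y₀) (x₁ 𝔽.* y₀) + γ * φ (x₀ 𝔽.* y₁) (x₁ 𝔽.* y₁)
    φ-*-expand γ x₀ x₁ y₀ y₁ = begin
      (ι x₀ + α * ι x₁) * (ι y₀ + γ * ι y₁)
        ≈⟨ distribˡ _ _ _ ⟩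
      (ι x₀ + α * ι x₁) * ι y₀ + (ι x₀ + α * ι x₁) * (γ * ι y₁)
        ≈⟨ +-cong (distribʳ _ _ _) (distribʳ _ _ _) ⟩
      (ι x₀ * ι y₀ + (α * ι x₁) * ι y₀) + (ι x₀ * (γ * ι y₁) + (α * ι x₁) * (γ * ι y₁))
        ≈⟨ +-cong (+-congˡ (*-assoc _ _ _)) (+-cong (x∙yz≈y∙xz _ _ _) αγ-swap) ⟩
      (ι x₀ * ι y₀ + α * (ι x₁ * ι y₀)) + (γ * (ι x₀ * ι y₁) + γ * (α * (ι x₁ * ι y₁)))
        ≈⟨ +-cong (+-cong (sym (*-homo _ _)) (*-congˡ (sym (*-homo _ _))))
                  (trans (sym (distribˡ _ _ _)) (*-congˡ (+-cong (sym (*-homo _ _)) (*-congˡ (sym (*-homo _ _)))))) ⟩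
      φ (x₀ 𝔽.* y₀) (x₁ 𝔽.* y₀) + γ * φ (x₀ 𝔽.* y₁) (x₁ 𝔽.* y₁)
        ∎
      where
      αγ-swap : (α * ι x₁) * (γ * ι y₁) ≈ γ * (α * (ι x₁ * ι y₁))
      αγ-swap = trans (*-assoc _ _ _) (trans (x∙yz≈y∙xz α (ι x₁) (γ * ι y₁))
                  (trans (*-congˡ (x∙yz≈y∙xz α γ (ι y₁))) (trans (x∙yz≈y∙xz (ι x₁) γ (α * ι y₁))
                  (*-congˡ (x∙yz≈y∙xz (ι x₁) α (ι y₁))))))

    NotRatio : Carrier → Set
    NotRatio β = ∀ a₀ a₁ b₀ b₁ → ¬ φ b₀ b₁ ≈ 0# → ¬ β * φ b₀ b₁ ≈ φ a₀ a₁

    -- The vector v encodes (a₀, a₁, b₀, b₁); a vector, so that IsRatio is decidable by enumeration.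
    IsRatio : Carrier → Set
    IsRatio x = ∃ λ (v : Vector 𝔽.Carrier 4) → ¬ φ (v f2) (v f3) ≈ 0# × x * φ (v f2) (v f3) ≈ φ (v f0) (v f1)

    IsRatio? : ∀ x → Dec (IsRatio x)
    IsRatio? x = 𝔽.any-vector?
      (λ v≋v' (φ≉0 , e) → (λ z → φ≉0 (trans (φ-cong (v≋v' _) (v≋v' _)) z)) ,
                         trans (*-congˡ (φ-cong (𝔽.sym (v≋v' _)) (𝔽.sym (v≋v' _)))) (trans e (φ-cong (v≋v' _) (v≋v' _))))
      (λ v → ¬? (φ (v f2) (v f3) ≟ 0#) ×-dec (x * φ (v f2) (v f3) ≟ φ (v f0) (v f1)))

    ratio-scale : ∀ x c a₀ a₁ b₀ b₁ → ¬ c 𝔽.≈ 𝔽.0# → ¬ φ b₀ b₁ ≈ 0# → x * φ b₀ b₁ ≈ φ a₀ a₁ →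
                  ¬ φ (c 𝔽.* b₀) (c 𝔽.* b₁) ≈ 0# × x * φ (c 𝔽.* b₀) (c 𝔽.* b₁) ≈ φ (c 𝔽.* a₀) (c 𝔽.* a₁)
    ratio-scale x c a₀ a₁ b₀ b₁ c≉0 φb≉0 e =
      (λ z → *-≉0 (ι-≉0 c≉0) φb≉0 (trans (ι*φ c b₀ b₁) z)) ,
      (begin
        x * φ (c 𝔽.* b₀) (c 𝔽.* b₁) ≈⟨ *-congˡ (ι*φ c b₀ b₁) ⟨
        x * (ι c * φ b₀ b₁)         ≈⟨ x∙yz≈y∙xz _ _ _ ⟩
        ι c * (x * φ b₀ b₁)         ≈⟨ *-congˡ e ⟩
        ι c * φ a₀ a₁               ≈⟨ ι*φ c a₀ a₁ ⟩
        φ (c 𝔽.* a₀) (c 𝔽.* a₁)    ∎)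

    -- Every ratio φ a / φ b can be written with b normalised to (1, t) or (0, 1); these
    -- normal forms, together with a, are indexed by F³ ⊎ F².
    #normal : ℕ
    #normal = NF ^ 3 ℕ.+ NF ^ 2

    denominator : Fin #normal → Carrier
    denominator = (λ i → φ 𝔽.1# (𝔽.vector {3} i f2)) ++ (λ _ → φ 𝔽.0# 𝔽.1#)

    numerator : Fin #normal → Carrier
    numerator = (λ i → φ (𝔽.vector {3} i f0) (𝔽.vector {3} i f1)) ++ (λ i → φ (𝔽.vector {2} i f0) (𝔽.vector {2} i f1))

    normal-form : ∀ x → IsRatio x → ∃ λ k → ¬ denominator k ≈ 0# × x * denominator k ≈ numerator k
    normal-form x (v , φb≉0 , e) with v f2 𝔽.≟ 𝔽.0#
    ... | no b₀≉0 = k , (λ z → φcb≉0 (trans (sym denominator≈) z)) , trans (*-congˡ denominator≈) (trans scaled numerator≈)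
      where
      c : 𝔽.Carrier
      c = 𝔽.inv (v f2) b₀≉0
      φcb≉0 : ¬ φ (c 𝔽.* v f2) (c 𝔽.* v f3) ≈ 0#
      φcb≉0 = proj₁ (ratio-scale x c (v f0) (v f1) (v f2) (v f3) (𝔽.inv≉0 _ b₀≉0) φb≉0 e)
      scaled : x * φ (c 𝔽.* v f2) (c 𝔽.* v f3) ≈ φ (c 𝔽.* v f0) (c 𝔽.* v f1)
      scaled = proj₂ (ratio-scale x c (v f0) (v f1) (v f2) (v f3) (𝔽.inv≉0 _ b₀≉0) φb≉0 e)
      t : Vector 𝔽.Carrier 3
      t f0 = c 𝔽.* v f0
      t f1 = c 𝔽.* v f1
      t f2 = c 𝔽.* v f3
      k : Fin #normal
      k = 𝔽.code t ↑ˡ (NF ^ 2)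
      denominator≈ : denominator k ≈ φ (c 𝔽.* v f2) (c 𝔽.* v f3)
      denominator≈ = trans (reflexive (lookup-++ˡ _ _ (𝔽.code t)))
                           (φ-cong (𝔽.sym (𝔽.*-inverseˡ _ b₀≉0)) (𝔽.sym (𝔽.vector-code t f2)))
      numerator≈ : φ (c 𝔽.* v f0) (c 𝔽.* v f1) ≈ numerator k
      numerator≈ = trans (φ-cong (𝔽.vector-code t f0) (𝔽.vector-code t f1)) (sym (reflexive (lookup-++ˡ _ _ (𝔽.code t))))
    ... | yes b₀≈0 = k , (λ z → φcb≉0 (trans (sym denominator≈) z)) , trans (*-congˡ denominator≈) (trans scaled numerator≈)
      where
      b₁≉0 : ¬ v f3 𝔽.≈ 𝔽.0#
      b₁≉0 b₁≈0 = φb≉0 (φ-zero b₀≈0 b₁≈0)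
      c : 𝔽.Carrier
      c = 𝔽.inv (v f3) b₁≉0
      φcb≉0 : ¬ φ (c 𝔽.* v f2) (c 𝔽.* v f3) ≈ 0#
      φcb≉0 = proj₁ (ratio-scale x c (v f0) (v f1) (v f2) (v f3) (𝔽.inv≉0 _ b₁≉0) φb≉0 e)
      scaled : x * φ (c 𝔽.* v f2) (c 𝔽.* v f3) ≈ φ (c 𝔽.* v f0) (c 𝔽.* v f1)
      scaled = proj₂ (ratio-scale x c (v f0) (v f1) (v f2) (v f3) (𝔽.inv≉0 _ b₁≉0) φb≉0 e)
      t : Vector 𝔽.Carrier 2
      t f0 = c 𝔽.* v f0
      t f1 = c 𝔽.* v f1
      k : Fin #normal
      k = (NF ^ 3) ↑ʳ 𝔽.code t
      denominator≈ : denominator k ≈ φ (c 𝔽.* v f2) (c 𝔽.* v f3)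
      denominator≈ = trans (reflexive (lookup-++ʳ {m = NF ^ 3} _ _ (𝔽.code t)))
                           (φ-cong (𝔽.sym (𝔽.trans (𝔽.*-congˡ b₀≈0) (𝔽.zeroʳ _))) (𝔽.sym (𝔽.*-inverseˡ _ b₁≉0)))
      numerator≈ : φ (c 𝔽.* v f0) (c 𝔽.* v f1) ≈ numerator k
      numerator≈ = trans (φ-cong (𝔽.vector-code t f0) (𝔽.vector-code t f1))
                         (sym (reflexive (lookup-++ʳ {m = NF ^ 3} _ _ (𝔽.code t))))

    ∃-NotRatio : #normal < NL → ∃ NotRatio
    ∃-NotRatio #normal<NL with injects-into-smaller⇒∃¬ IsRatio? #normal<NL (λ x r → proj₁ (normal-form x r)) same-normal-form
      where
      same-normal-form : ∀ {x y rx ry} → proj₁ (normal-form x rx) ≡ proj₁ (normal-form y ry) → x ≈ y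
      same-normal-form {x} {y} {rx} {ry} e =
        *-cancelˡ (denominator k) d≉0 (trans (*-comm _ _) (trans xd≈n (trans (sym yd≈n) (*-comm _ _))))
        where
        k : Fin #normal
        k = proj₁ (normal-form x rx)
        d≉0 : ¬ denominator k ≈ 0#
        d≉0 = proj₁ (proj₂ (normal-form x rx))
        xd≈n : x * denominator k ≈ numerator k
        xd≈n = proj₂ (proj₂ (normal-form x rx))
        yd≈n : y * denominator k ≈ numerator k
        yd≈n = P.subst (λ k → y * denominator k ≈ numerator k) (P.sym e) (proj₂ (proj₂ (normal-form y ry)))
    ... | β , β∉ = β , λ a₀ a₁ b₀ b₁ φb≉0 e → β∉ ((a₀ V.∷ a₁ V.∷ b₀ V.∷ b₁ V.∷ V.[]) , φb≉0 , e)

-- Representations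

module Representation (F L : Field) (E : Extension F L) {NF NL : ℕ} (hsF : HasSize F NF) (hsL : HasSize L NL) where
  open ExtensionProperties F L E hsF hsL
  open Finite L hsL

  -- G Yᵀ: `RepRank F L E G Y r` unfolds to `RankIs L (image G Y) r`.
  image : ∀ {k n s} → Matrix k n → 𝔽.Matrix s n → Matrix k s
  image G Y = mul L G (transpose (λ i j → ι (Y i j)))

  image-identity-row : ∀ {k n s} (G : Matrix k n) (Y : 𝔽.Matrix s n) t j → Y t ≡ 𝔽.identity j → ∀ i → image G Y i t ≈ G i j
  image-identity-row {n = n} G Y t j Yt≡δj i =
    trans (reflexive (P.cong (λ y → sum (λ l → G i l * ι (y l))) Yt≡δj))
          (trans (sum-cong {n} (λ l → trans (*-congˡ (ι-δ j l)) (*-comm _ _))) (sum-δ j (G i)))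
    where
    ι-δ : ∀ j l → ι (𝔽.δ j l) ≈ δ j l
    ι-δ j l with j FinP.≟ l
    ... | yes _ = 1#-homo
    ... | no  _ = 0#-homo

module UniformRepresentation (F L : Field) (E : Extension F L) {NF NL : ℕ} (hsF : HasSize F NF) (hsL : HasSize L NL)
                             (α : Field.Carrier L) (α∉F : ExtensionProperties.NotInBase F L E hsF hsL α) where
  open ExtensionProperties F L E hsF hsL
  open Finite L hsL
  open Representation F L E hsF hsL
  open Span α α∉F

  G₁ : Matrix 1 2
  G₁ f0 f0 = 1#
  G₁ f0 f1 = α

  image-G₁ : ∀ {s} (Y : 𝔽.Matrix s 2) j → image G₁ Y f0 j ≈ φ (Y j f0) (Y j f1)
  image-G₁ Y j = +-cong (*-identityˡ _) (+-identityʳ _)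

  rank-image-G₁ : ∀ {s} (Y : 𝔽.Matrix s 2) {d} → RankIs F Y d → RankIs L (image G₁ Y) (1 ⊓ d)
  rank-image-G₁ Y {zero} rY = zero⇒rank0 (image G₁ Y) λ { f0 j →
    trans (image-G₁ Y j) (φ-zero (𝔽.rank0⇒zero Y rY j f0) (𝔽.rank0⇒zero Y rY j f1)) }
  rank-image-G₁ Y {suc d} rY with 𝔽.rank>0⇒nonzero-entry Y rY
  ... | i , j , Yij≉0 = Indep⇒rank (image G₁ Y) independent
    where
    entry≉0 : ¬ image G₁ Y f0 i ≈ 0#
    entry≉0 e with φ≈0⇒≈0 _ _ (trans (sym (image-G₁ Y i)) e)
    ... | Yi0≈0 , Yi1≈0 = Yij≉0 (Yi≈0 j)
      where
      Yi≈0 : ∀ j → Y i j 𝔽.≈ 𝔽.0#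
      Yi≈0 f0 = Yi0≈0
      Yi≈0 f1 = Yi1≈0
    independent : Indep L (image G₁ Y)
    independent c c·G₁Yᵀ≈0 f0 = x*y≈0⇒y≈0 entry≉0 (trans (*-comm _ _) (trans (sym (+-identityʳ _)) (c·G₁Yᵀ≈0 i)))

  G₁-represents : Representable F L E (Uniform F 1 2)
  G₁-represents = 1 , G₁ , λ Y r → mk⇔
    (λ { (d , rY , P.refl) → rank-image-G₁ Y rY })
    (λ r-image → let (d , rY) = 𝔽.rank-exists Y in d , rY , rank-unique (image G₁ Y) r-image (rank-image-G₁ Y rY))

module DirectSumRepresentation (F L : Field) (E : Extension F L) {NF NL : ℕ} (hsF : HasSize F NF) (hsL : HasSize L NL)
         (α : Field.Carrier L) (α∉F : ExtensionProperties.NotInBase F L E hsF hsL α)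
         (β : Field.Carrier L) (β∉ratios : ExtensionProperties.Span.NotRatio F L E hsF hsL α α∉F β) where
  open ExtensionProperties F L E hsF hsL
  open Finite L hsL
  open Representation F L E hsF hsL
  open Span α α∉F
  module ⊕ = DirectSumRank F hsF
  open import Relation.Binary.Reasoning.Setoid setoid

  β∉F : NotInBase β
  β∉F a β≈ιa = β∉ratios a 𝔽.0# 𝔽.1# 𝔽.0# (λ e → 𝔽.1≉0 (proj₁ (φ≈0⇒≈0 _ _ e))) (begin
    β * φ 𝔽.1# 𝔽.0# ≈⟨ *-congˡ (trans (+-cong 1#-homo (*ι0 α)) (+-identityʳ _)) ⟩
    β * 1#          ≈⟨ *-identityʳ _ ⟩
    β               ≈⟨ β≈ιa ⟩
    ι a             ≈⟨ trans (+-congˡ (*ι0 α)) (+-identityʳ _) ⟨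
    φ a 𝔽.0#        ∎)

  module Ψ = Span β β∉F

  ψ : 𝔽.Carrier → 𝔽.Carrier → Carrier
  ψ = Ψ.φ

  -- Θ is injective exactly because 1, α, β, αβ are linearly independent over F.
  Θ : 𝔽.Carrier → 𝔽.Carrier → 𝔽.Carrier → 𝔽.Carrier → Carrier
  Θ a₀ a₁ b₀ b₁ = φ a₀ a₁ + β * φ b₀ b₁

  Θ≈0⇒≈0 : ∀ a₀ a₁ b₀ b₁ → Θ a₀ a₁ b₀ b₁ ≈ 0# →
           a₀ 𝔽.≈ 𝔽.0# × a₁ 𝔽.≈ 𝔽.0# × b₀ 𝔽.≈ 𝔽.0# × b₁ 𝔽.≈ 𝔽.0#
  Θ≈0⇒≈0 a₀ a₁ b₀ b₁ Θ≈0 with φ b₀ b₁ ≟ 0#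
  ... | no φb≉0 = ⊥-elim (β∉ratios (𝔽.- a₀) (𝔽.- a₁) b₀ b₁ φb≉0
                   (trans (inverseˡ-unique _ _ (trans (+-comm _ _) Θ≈0)) (sym (φ-neg a₀ a₁))))
  ... | yes φb≈0 with φ≈0⇒≈0 b₀ b₁ φb≈0
                    | φ≈0⇒≈0 a₀ a₁ (trans (sym (+-identityʳ _)) (trans (+-congˡ (sym (trans (*-congˡ φb≈0) (zeroʳ β)))) Θ≈0))
  ...   | b₀≈0 , b₁≈0 | a₀≈0 , a₁≈0 = a₀≈0 , a₁≈0 , b₀≈0 , b₁≈0

  Θ-sub : ∀ a₀ a₁ b₀ b₁ a₀' a₁' b₀' b₁' →
          Θ (a₀ 𝔽.- a₀') (a₁ 𝔽.- a₁') (b₀ 𝔽.- b₀') (b₁ 𝔽.- b₁') ≈ Θ a₀ a₁ b₀ b₁ - Θ a₀' a₁' b₀' b₁'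
  Θ-sub a₀ a₁ b₀ b₁ a₀' a₁' b₀' b₁' = begin
    φ (a₀ 𝔽.- a₀') (a₁ 𝔽.- a₁') + β * φ (b₀ 𝔽.- b₀') (b₁ 𝔽.- b₁')
      ≈⟨ +-cong (φ-sub _ _ _ _) (trans (*-congˡ (φ-sub _ _ _ _)) (x[y-z]≈xy-xz _ _ _)) ⟩
    (φ a₀ a₁ - φ a₀' a₁') + (β * φ b₀ b₁ - β * φ b₀' b₁')
      ≈⟨ [a-b]+[c-d]≈[a+c]-[b+d] _ _ _ _ ⟩
    Θ a₀ a₁ b₀ b₁ - Θ a₀' a₁' b₀' b₁'
      ∎

  Θ-injective : ∀ {a₀ a₁ b₀ b₁ a₀' a₁' b₀' b₁'} → Θ a₀ a₁ b₀ b₁ ≈ Θ a₀' a₁' b₀' b₁' →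
                a₀ 𝔽.≈ a₀' × a₁ 𝔽.≈ a₁' × b₀ 𝔽.≈ b₀' × b₁ 𝔽.≈ b₁'
  Θ-injective {a₀} {a₁} {b₀} {b₁} {a₀'} {a₁'} {b₀'} {b₁'} e
    with Θ≈0⇒≈0 _ _ _ _ (trans (Θ-sub a₀ a₁ b₀ b₁ a₀' a₁' b₀' b₁') (x≈y⇒x∙y⁻¹≈ε e))
  ... | d₀ , d₁ , d₂ , d₃ = 𝔽.x∙y⁻¹≈ε⇒x≈y _ _ d₀ , 𝔽.x∙y⁻¹≈ε⇒x≈y _ _ d₁ , 𝔽.x∙y⁻¹≈ε⇒x≈y _ _ d₂ , 𝔽.x∙y⁻¹≈ε⇒x≈y _ _ d₃

  leftImage rightImage : Vector 𝔽.Carrier 4 → Carrier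
  leftImage  y = φ (y f0) (y f1)
  rightImage y = ψ (y f2) (y f3)

  -- Comparing coefficients of 1, α, β, αβ in a 2×2 minor of the image.
  cross : ∀ (y z : Vector 𝔽.Carrier 4) → leftImage z * rightImage y ≈ leftImage y * rightImage z →
          ∀ (a b : Fin 2) → z (a ↑ˡ 2) 𝔽.* y (2 ↑ʳ b) 𝔽.≈ y (a ↑ˡ 2) 𝔽.* z (2 ↑ʳ b)
  cross y z e = coefficient
    where
    coefficients : z f0 𝔽.* y f2 𝔽.≈ y f0 𝔽.* z f2 × z f1 𝔽.* y f2 𝔽.≈ y f1 𝔽.* z f2 ×
                   z f0 𝔽.* y f3 𝔽.≈ y f0 𝔽.* z f3 × z f1 𝔽.* y f3 𝔽.≈ y f1 𝔽.* z f3
    coefficients = Θ-injective (trans (sym (φ-*-expand β _ _ _ _)) (trans e (φ-*-expand β _ _ _ _)))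
    coefficient : ∀ (a b : Fin 2) → z (a ↑ˡ 2) 𝔽.* y (2 ↑ʳ b) 𝔽.≈ y (a ↑ˡ 2) 𝔽.* z (2 ↑ʳ b)
    coefficient f0 f0 = proj₁ coefficients
    coefficient f1 f0 = proj₁ (proj₂ coefficients)
    coefficient f0 f1 = proj₁ (proj₂ (proj₂ coefficients))
    coefficient f1 f1 = proj₂ (proj₂ (proj₂ coefficients))

  leftImage≉0 : ∀ y (a : Fin 2) → ¬ y (a ↑ˡ 2) 𝔽.≈ 𝔽.0# → ¬ leftImage y ≈ 0#
  leftImage≉0 y f0 ya≉0 e = ya≉0 (proj₁ (φ≈0⇒≈0 _ _ e))
  leftImage≉0 y f1 ya≉0 e = ya≉0 (proj₂ (φ≈0⇒≈0 _ _ e))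

  rightImage≉0 : ∀ y (b : Fin 2) → ¬ y (2 ↑ʳ b) 𝔽.≈ 𝔽.0# → ¬ rightImage y ≈ 0#
  rightImage≉0 y f0 yb≉0 e = yb≉0 (proj₁ (Ψ.φ≈0⇒≈0 _ _ e))
  rightImage≉0 y f1 yb≉0 e = yb≉0 (proj₂ (Ψ.φ≈0⇒≈0 _ _ e))

  leftImage≉0⇒ : ∀ y → ¬ leftImage y ≈ 0# → ∃ λ (a : Fin 2) → ¬ y (a ↑ˡ 2) 𝔽.≈ 𝔽.0#
  leftImage≉0⇒ y u≉0 with φ≉0⇒≉0 u≉0
  ... | inj₁ y₀≉0 = f0 , y₀≉0
  ... | inj₂ y₁≉0 = f1 , y₁≉0

  rightImage≉0⇒ : ∀ y → ¬ rightImage y ≈ 0# → ∃ λ (b : Fin 2) → ¬ y (2 ↑ʳ b) 𝔽.≈ 𝔽.0#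
  rightImage≉0⇒ y v≉0 with Ψ.φ≉0⇒≉0 v≉0
  ... | inj₁ y₂≉0 = f0 , y₂≉0
  ... | inj₂ y₃≉0 = f1 , y₃≉0

  G₂ : Matrix 2 4
  G₂ f0 f0 = 1#
  G₂ f0 f1 = α
  G₂ f0 f2 = 0#
  G₂ f0 f3 = 0#
  G₂ f1 f0 = 0#
  G₂ f1 f1 = 0#
  G₂ f1 f2 = 1#
  G₂ f1 f3 = β

  image-G₂₀ : ∀ {s} (Y : 𝔽.Matrix s 4) j → image G₂ Y f0 j ≈ leftImage (Y j)
  image-G₂₀ Y j = +-cong (*-identityˡ _)
    (trans (+-congˡ (trans (+-cong (zeroˡ _) (trans (+-congʳ (zeroˡ _)) (+-identityˡ _))) (+-identityˡ _))) (+-identityʳ _))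

  image-G₂₁ : ∀ {s} (Y : 𝔽.Matrix s 4) j → image G₂ Y f1 j ≈ rightImage (Y j)
  image-G₂₁ Y j =
    trans (+-cong (zeroˡ _) (+-cong (zeroˡ _) (+-cong (*-identityˡ _) (+-identityʳ _)))) (trans (+-identityˡ _) (+-identityˡ _))

  row₀≉0 : ∀ {s} (Y : 𝔽.Matrix s 4) i a → ¬ Y i (a ↑ˡ 2) 𝔽.≈ 𝔽.0# → ¬ image G₂ Y f0 i ≈ 0#
  row₀≉0 Y i a Yia≉0 e = leftImage≉0 (Y i) a Yia≉0 (trans (sym (image-G₂₀ Y i)) e)

  row₁≉0 : ∀ {s} (Y : 𝔽.Matrix s 4) i b → ¬ Y i (2 ↑ʳ b) 𝔽.≈ 𝔽.0# → ¬ image G₂ Y f1 i ≈ 0#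
  row₁≉0 Y i b Yib≉0 e = rightImage≉0 (Y i) b Yib≉0 (trans (sym (image-G₂₁ Y i)) e)

  image-G₂-nonzero : ∀ {s} (Y : 𝔽.Matrix s 4) {d} → RankIs F Y (suc d) → ∃ λ r → ∃ λ i → ¬ image G₂ Y r i ≈ 0#
  image-G₂-nonzero Y rY with 𝔽.rank>0⇒nonzero-entry Y rY
  ... | i , f0 , Yij≉0 = f0 , i , row₀≉0 Y i f0 Yij≉0
  ... | i , f1 , Yij≉0 = f0 , i , row₀≉0 Y i f1 Yij≉0
  ... | i , f2 , Yij≉0 = f1 , i , row₁≉0 Y i f0 Yij≉0
  ... | i , f3 , Yij≉0 = f1 , i , row₁≉0 Y i f1 Yij≉0

  rank-image-G₂-0 : ∀ {s} (Y : 𝔽.Matrix s 4) → RankIs F Y 0 → RankIs L (image G₂ Y) 0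
  rank-image-G₂-0 Y rY = zero⇒rank0 (image G₂ Y) λ
    { f0 j → trans (image-G₂₀ Y j) (φ-zero (Y≈0 j f0) (Y≈0 j f1))
    ; f1 j → trans (image-G₂₁ Y j) (Ψ.φ-zero (Y≈0 j f2) (Y≈0 j f3)) }
    where
    Y≈0 : ∀ i j → Y i j 𝔽.≈ 𝔽.0#
    Y≈0 = 𝔽.rank0⇒zero Y rY

  rank-image-G₂-πₗ≈0 : ∀ {s} (Y : 𝔽.Matrix s 4) {d} → RankIs F Y (suc d) → RankIs F (⊕.πₗ Y) 0 → RankIs L (image G₂ Y) 1
  rank-image-G₂-πₗ≈0 Y rY rY₁ = nonzero∧RowSub-row⇒rank1 (image G₂ Y) (λ _ → image G₂ Y f1) ⊆row₁ (image-G₂-nonzero Y rY)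
    where
    Y₁≈0 : ∀ i j → ⊕.πₗ Y i j 𝔽.≈ 𝔽.0#
    Y₁≈0 = 𝔽.rank0⇒zero (⊕.πₗ Y) rY₁
    ⊆row₁ : RowSub L (image G₂ Y) (λ _ → image G₂ Y f1)
    ⊆row₁ f0 = (λ _ → 0#) , λ k →
      trans (image-G₂₀ Y k) (trans (φ-zero (Y₁≈0 k f0) (Y₁≈0 k f1)) (sym (trans (+-identityʳ _) (zeroˡ _))))
    ⊆row₁ f1 = (λ _ → 1#) , λ k → sym (trans (+-identityʳ _) (*-identityˡ _))

  rank-image-G₂-πᵣ≈0 : ∀ {s} (Y : 𝔽.Matrix s 4) {d} → RankIs F Y (suc d) → RankIs F (⊕.πᵣ Y) 0 → RankIs L (image G₂ Y) 1
  rank-image-G₂-πᵣ≈0 Y rY rY₂ = nonzero∧RowSub-row⇒rank1 (image G₂ Y) (λ _ → image G₂ Y f0) ⊆row₀ (image-G₂-nonzero Y rY)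
    where
    Y₂≈0 : ∀ i j → ⊕.πᵣ Y i j 𝔽.≈ 𝔽.0#
    Y₂≈0 = 𝔽.rank0⇒zero (⊕.πᵣ Y) rY₂
    ⊆row₀ : RowSub L (image G₂ Y) (λ _ → image G₂ Y f0)
    ⊆row₀ f0 = (λ _ → 1#) , λ k → sym (trans (+-identityʳ _) (*-identityˡ _))
    ⊆row₀ f1 = (λ _ → 0#) , λ k →
      trans (image-G₂₁ Y k) (trans (Ψ.φ-zero (Y₂≈0 k f0) (Y₂≈0 k f1)) (sym (trans (+-identityʳ _) (zeroˡ _))))

  rank-image-G₂-1 : ∀ {s} (Y : 𝔽.Matrix s 4) → RankIs F Y 1 → RankIs L (image G₂ Y) 1
  rank-image-G₂-1 Y rY with 𝔽.rank⇒basis Y rY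
  ... | basis , _ , _ , Y⊆basis = nonzero∧RowSub-row⇒rank1 (image G₂ Y) scalars ⊆scalars (image-G₂-nonzero Y rY)
    where
    y : Vector 𝔽.Carrier 4
    y = basis f0
    t : ∀ k → 𝔽.Carrier
    t k = proj₁ (Y⊆basis k) f0
    Yk≈tky : ∀ k j → Y k j 𝔽.≈ t k 𝔽.* y j
    Yk≈tky k j = 𝔽.trans (proj₂ (Y⊆basis k) j) (𝔽.+-identityʳ _)
    scalars : Matrix 1 _
    scalars _ k = ι (t k)
    ⊆scalars : RowSub L (image G₂ Y) scalars
    ⊆scalars f0 = (λ _ → leftImage y) , λ k → begin
      image G₂ Y f0 k                     ≈⟨ image-G₂₀ Y k ⟩
      φ (Y k f0) (Y k f1)                 ≈⟨ φ-cong (Yk≈tky k f0) (Yk≈tky k f1) ⟩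
      φ (t k 𝔽.* y f0) (t k 𝔽.* y f1)     ≈⟨ ι*φ _ _ _ ⟨
      ι (t k) * leftImage y               ≈⟨ *-comm _ _ ⟩
      leftImage y * ι (t k)               ≈⟨ +-identityʳ _ ⟨
      leftImage y * ι (t k) + 0#          ∎
    ⊆scalars f1 = (λ _ → rightImage y) , λ k → begin
      image G₂ Y f1 k                     ≈⟨ image-G₂₁ Y k ⟩
      ψ (Y k f2) (Y k f3)                 ≈⟨ Ψ.φ-cong (Yk≈tky k f2) (Yk≈tky k f3) ⟩
      ψ (t k 𝔽.* y f2) (t k 𝔽.* y f3)     ≈⟨ Ψ.ι*φ _ _ _ ⟨
      ι (t k) * rightImage y              ≈⟨ *-comm _ _ ⟩
      rightImage y * ι (t k)              ≈⟨ +-identityʳ _ ⟨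
      rightImage y * ι (t k) + 0#         ∎

  -- If the two image rows were dependent, all 2×2 minors would vanish, and by `cross` every row of Y
  -- would be a multiple of one with both halves nonzero, contradicting dim Y ≥ 2.
  rank-image-G₂-2 : ∀ {s} (Y : 𝔽.Matrix s 4) {d r₁ r₂} → RankIs F Y (suc (suc d)) →
                    RankIs F (⊕.πₗ Y) (suc r₁) → RankIs F (⊕.πᵣ Y) (suc r₂) → RankIs L (image G₂ Y) 2
  rank-image-G₂-2 {s} Y {d} rY rY₁ rY₂ = Indep⇒rank N independent
    where
    N : Matrix 2 s
    N = image G₂ Y
    left-witness : ∃ λ i → ∃ λ a → ¬ ⊕.πₗ Y i a 𝔽.≈ 𝔽.0#
    left-witness = 𝔽.rank>0⇒nonzero-entry (⊕.πₗ Y) rY₁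
    right-witness : ∃ λ i → ∃ λ b → ¬ ⊕.πᵣ Y i b 𝔽.≈ 𝔽.0#
    right-witness = 𝔽.rank>0⇒nonzero-entry (⊕.πᵣ Y) rY₂
    i₁ i₂ : Fin s
    i₁ = proj₁ left-witness
    i₂ = proj₁ right-witness
    N₀i₁≉0 : ¬ N f0 i₁ ≈ 0#
    N₀i₁≉0 = row₀≉0 Y i₁ (proj₁ (proj₂ left-witness)) (proj₂ (proj₂ left-witness))
    N₁i₂≉0 : ¬ N f1 i₂ ≈ 0#
    N₁i₂≉0 = row₁≉0 Y i₂ (proj₁ (proj₂ right-witness)) (proj₂ (proj₂ right-witness))
    y : Vector 𝔽.Carrier 4
    y = Y i₂
    minors≉0 : ¬ (∀ j k → N f0 j * N f1 k ≈ N f0 k * N f1 j)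
    minors≉0 minors = 2+d≰1 (NP.≤-trans (𝔽.rank-mono Y (𝔽.row y) Y⊆y rY r[y]) (𝔽.rank≤rows (𝔽.row y) r[y]))
      where
      2+d≰1 : ¬ suc (suc d) ≤ 1
      2+d≰1 (s≤s ())
      N₀i₂≉0 : ¬ N f0 i₂ ≈ 0#
      N₀i₂≉0 e = *-≉0 N₀i₁≉0 N₁i₂≉0 (trans (minors i₁ i₂) (trans (*-congʳ e) (zeroˡ _)))
      a : ∃ λ (a : Fin 2) → ¬ y (a ↑ˡ 2) 𝔽.≈ 𝔽.0#
      a = leftImage≉0⇒ y (λ e → N₀i₂≉0 (trans (image-G₂₀ Y i₂) e))
      b : ∃ λ (b : Fin 2) → ¬ y (2 ↑ʳ b) 𝔽.≈ 𝔽.0#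
      b = rightImage≉0⇒ y (λ e → N₁i₂≉0 (trans (image-G₂₁ Y i₂) e))
      Yk∈Fy : ∀ k → ∃ λ t → ∀ j → Y k j 𝔽.≈ t 𝔽.* y j
      Yk∈Fy k = ⊕.proportional y (Y k) (proj₁ a) (proj₁ b) (proj₂ a) (proj₂ b)
        (cross y (Y k) (trans (*-cong (sym (image-G₂₀ Y k)) (sym (image-G₂₁ Y i₂)))
                              (trans (minors k i₂) (*-cong (image-G₂₀ Y i₂) (image-G₂₁ Y k)))))
      Y⊆y : RowSub F Y (𝔽.row y)
      Y⊆y k = (λ _ → proj₁ (Yk∈Fy k)) , λ j → 𝔽.trans (proj₂ (Yk∈Fy k) j) (𝔽.sym (𝔽.+-identityʳ _))
      r[y] : RankIs F (𝔽.row y) (proj₁ (𝔽.rank-exists (𝔽.row y)))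
      r[y] = proj₂ (𝔽.rank-exists (𝔽.row y))
    independent : Indep L N
    independent c c·N≈0 = coefficient≈0
      where
      dependence : ∀ j → c f0 * N f0 j + c f1 * N f1 j ≈ 0#
      dependence j = trans (+-congˡ (sym (+-identityʳ _))) (c·N≈0 j)
      coefficient≈0 : ∀ i → c i ≈ 0#
      coefficient≈0 i with c f0 ≟ 0#
      ... | no c₀≉0 = ⊥-elim (minors≉0 (dependent⇒minors≈ (N f0) (N f1) (c f0) (c f1) c₀≉0 dependence))
      coefficient≈0 f0 | yes c₀≈0 = c₀≈0
      coefficient≈0 f1 | yes c₀≈0 = x*y≈0⇒y≈0 N₁i₂≉0 (trans (*-comm _ _)
        (trans (sym (+-identityˡ _)) (trans (+-congʳ (sym (trans (*-congʳ c₀≈0) (zeroˡ _)))) (dependence i₂))))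

  rank-image-G₂ : ∀ {s} (Y : 𝔽.Matrix s 4) {d r₁ r₂} → RankIs F Y d →
                  RankIs F (⊕.πₗ Y) r₁ → RankIs F (⊕.πᵣ Y) r₂ → RankIs L (image G₂ Y) (rank⊕ d r₁ r₂)
  rank-image-G₂ Y {zero} {r₁} {r₂} rY _ _ =
    P.subst (RankIs L (image G₂ Y)) (P.sym (NP.⊓-zeroʳ (1 ⊓ r₁ ℕ.+ 1 ⊓ r₂))) (rank-image-G₂-0 Y rY)
  rank-image-G₂ Y {suc d} {zero} {zero} rY rY₁ rY₂ with ⊕.rank≤rank-π₁+rank-π₂ Y rY rY₁ rY₂
  ... | ()
  rank-image-G₂ Y {suc d}       {zero}   {suc r₂} rY rY₁ rY₂ = rank-image-G₂-πₗ≈0 Y rY rY₁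
  rank-image-G₂ Y {suc d}       {suc r₁} {zero}   rY rY₁ rY₂ = rank-image-G₂-πᵣ≈0 Y rY rY₂
  rank-image-G₂ Y {suc zero}    {suc r₁} {suc r₂} rY rY₁ rY₂ = rank-image-G₂-1 Y rY
  rank-image-G₂ Y {suc (suc d)} {suc r₁} {suc r₂} rY rY₁ rY₂ = rank-image-G₂-2 Y rY rY₁ rY₂

  G₂-represents : Representable F L E ⊕.U⊕U
  G₂-represents = 2 , G₂ , λ Y r →
    let rY  = proj₂ (𝔽.rank-exists Y)
        rY₁ = proj₂ (𝔽.rank-exists (⊕.πₗ Y))
        rY₂ = proj₂ (𝔽.rank-exists (⊕.πᵣ Y))
        U⊕U⇔ = ⊕.U⊕U-rank Y rY rY₁ rY₂ r
        r-image = rank-image-G₂ Y rY rY₁ rY₂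
    in mk⇔ (λ U⊕U-r → P.subst (RankIs L (image G₂ Y)) (P.sym (Equivalence.to U⊕U⇔ U⊕U-r)) r-image)
           (λ image-r → Equivalence.from U⊕U⇔ (rank-unique (image G₂ Y) image-r r-image))

module DirectSumObstruction (F L : Field) (E : Extension F L) {NF NL : ℕ} (hsF : HasSize F NF) (hsL : HasSize L NL)
         {k : ℕ} (G : Mat (Field.Carrier L) k 4)
         (represents : ∀ {s} (Y : Mat (Field.Carrier F) s 4) r → DirectSumRank.U⊕U F hsF Y r ⇔ RepRank F L E G Y r) where
  open ExtensionProperties F L E hsF hsL
  open Finite L hsL
  open Representation F L E hsF hsL
  module ⊕ = DirectSumRank F hsF
  open import Relation.Binary.Reasoning.Setoid setoid

  rank-image : ∀ {s} (Y : 𝔽.Matrix s 4) {d r₁ r₂} → RankIs F Y d → RankIs F (⊕.πₗ Y) r₁ → RankIs F (⊕.πᵣ Y) r₂ →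
               RankIs L (image G Y) (rank⊕ d r₁ r₂)
  rank-image Y rY rY₁ rY₂ = Equivalence.to (represents Y _) (Equivalence.from (⊕.U⊕U-rank Y rY rY₁ rY₂ _) P.refl)

  rank-image-πᵣ≈0 : ∀ {s} (Y : 𝔽.Matrix s 4) {d} → RankIs F Y d → (∀ i j → ⊕.πᵣ Y i j 𝔽.≈ 𝔽.0#) →
                    RankIs L (image G Y) (1 ⊓ d)
  rank-image-πᵣ≈0 Y rY Y₂≈0 =
    P.subst (RankIs L (image G Y)) (rank⊕-r₂≡0 (⊕.rank≤rank-π₁+rank-π₂ Y rY rY₁ rY₂)) (rank-image Y rY rY₁ rY₂)
    where
    rY₁ : RankIs F (⊕.πₗ Y) (proj₁ (𝔽.rank-exists (⊕.πₗ Y)))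
    rY₁ = proj₂ (𝔽.rank-exists (⊕.πₗ Y))
    rY₂ : RankIs F (⊕.πᵣ Y) 0
    rY₂ = 𝔽.zero⇒rank0 (⊕.πᵣ Y) Y₂≈0

  rank-image-πₗ≈0 : ∀ {s} (Y : 𝔽.Matrix s 4) {d} → RankIs F Y d → (∀ i j → ⊕.πₗ Y i j 𝔽.≈ 𝔽.0#) →
                    RankIs L (image G Y) (1 ⊓ d)
  rank-image-πₗ≈0 Y rY Y₁≈0 =
    P.subst (RankIs L (image G Y)) (rank⊕-r₁≡0 (⊕.rank≤rank-π₁+rank-π₂ Y rY rY₁ rY₂)) (rank-image Y rY rY₁ rY₂)
    where
    rY₁ : RankIs F (⊕.πₗ Y) 0
    rY₁ = 𝔽.zero⇒rank0 (⊕.πₗ Y) Y₁≈0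
    rY₂ : RankIs F (⊕.πᵣ Y) (proj₁ (𝔽.rank-exists (⊕.πᵣ Y)))
    rY₂ = proj₂ (𝔽.rank-exists (⊕.πᵣ Y))

  unit : Fin 4 → Vector 𝔽.Carrier 4
  unit = 𝔽.identity

  column≉0 : ∀ j → RankIs L (image G (𝔽.row (unit j))) 1 → ∃ λ i → ¬ G i j ≈ 0#
  column≉0 j rank1 with rank>0⇒nonzero-entry (image G (𝔽.row (unit j))) rank1
  ... | i , f0 , entry≉0 = i , λ Gij≈0 → entry≉0 (trans (image-identity-row G (𝔽.row (unit j)) f0 j P.refl i) Gij≈0)

  columns-proportional : ∀ a b → RankIs L (image G (𝔽.rows (unit a) (unit b))) 1 → (∃ λ i → ¬ G i a ≈ 0#) →
                         ∃ λ γ → ∀ i → G i b ≈ γ * G i a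
  columns-proportional a b rank1 (i₀ , Gi₀a≉0) = proj₁ γ-proportional ,
    λ i → trans (sym (column-b i)) (trans (proj₂ γ-proportional i) (*-congˡ (column-a i)))
    where
    Y : 𝔽.Matrix 2 4
    Y = 𝔽.rows (unit a) (unit b)
    column-a : ∀ i → image G Y i f0 ≈ G i a
    column-a = image-identity-row G Y f0 a P.refl
    column-b : ∀ i → image G Y i f1 ≈ G i b
    column-b = image-identity-row G Y f1 b P.refl
    γ-proportional : ∃ λ γ → ∀ i → image G Y i f1 ≈ γ * image G Y i f0
    γ-proportional = rank1⇒columns-proportional (image G Y) rank1 (λ e → Gi₀a≉0 (trans (sym (column-a i₀)) e))

  -- ⟨e₀⟩, ⟨e₂⟩, ⟨e₀, e₁⟩ and ⟨e₂, e₃⟩ each lie in one summand, so their images have rank 1.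
  column₁≈α*column₀ : ∃ λ α → ∀ i → G i f1 ≈ α * G i f0
  column₁≈α*column₀ = columns-proportional f0 f1
    (rank-image-πᵣ≈0 (𝔽.rows (unit f0) (unit f1))
                     (𝔽.Indep⇒rank (𝔽.rows (unit f0) (unit f1))
                                   (𝔽.Indep-rows (unit f0) (unit f1) f0 f1 𝔽.refl 𝔽.refl 𝔽.refl 𝔽.refl))
                     (λ { f0 f0 → 𝔽.refl ; f0 f1 → 𝔽.refl ; f1 f0 → 𝔽.refl ; f1 f1 → 𝔽.refl }))
    (column≉0 f0 (rank-image-πᵣ≈0 (𝔽.row (unit f0)) (𝔽.Indep⇒rank (𝔽.row (unit f0)) (𝔽.Indep-row (unit f0) f0 𝔽.1≉0))
                                  (λ { _ f0 → 𝔽.refl ; _ f1 → 𝔽.refl })))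

  column₃≈β*column₂ : ∃ λ β → ∀ i → G i f3 ≈ β * G i f2
  column₃≈β*column₂ = columns-proportional f2 f3
    (rank-image-πₗ≈0 (𝔽.rows (unit f2) (unit f3))
                     (𝔽.Indep⇒rank (𝔽.rows (unit f2) (unit f3))
                                   (𝔽.Indep-rows (unit f2) (unit f3) f2 f3 𝔽.refl 𝔽.refl 𝔽.refl 𝔽.refl))
                     (λ { f0 f0 → 𝔽.refl ; f0 f1 → 𝔽.refl ; f1 f0 → 𝔽.refl ; f1 f1 → 𝔽.refl }))
    (column≉0 f2 (rank-image-πₗ≈0 (𝔽.row (unit f2)) (𝔽.Indep⇒rank (𝔽.row (unit f2)) (𝔽.Indep-row (unit f2) f2 𝔽.1≉0))
                                  (λ { _ f0 → 𝔽.refl ; _ f1 → 𝔽.refl })))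

  module Columns (α : Carrier) (G₁≈αG₀ : ∀ i → G i f1 ≈ α * G i f0)
                 (β : Carrier) (G₃≈βG₂ : ∀ i → G i f3 ≈ β * G i f2) where

    α∉F : NotInBase α
    α∉F a α≈ιa = 1≢0 (rank-unique (image G Y) (rank-image-πᵣ≈0 Y rY (λ { _ f0 → 𝔽.refl ; _ f1 → 𝔽.refl }))
                                             (zero⇒rank0 (image G Y) (λ { i f0 → image≈0 i })))
      where
      1≢0 : 1 ≢ 0
      1≢0 ()
      Y : 𝔽.Matrix 1 4
      Y = 𝔽.row (a V.∷ 𝔽.- 𝔽.1# V.∷ 𝔽.0# V.∷ 𝔽.0# V.∷ V.[])
      rY : RankIs F Y 1
      rY = 𝔽.Indep⇒rank Y (𝔽.Indep-row _ f1 𝔽.-1≉0)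
      image≈0 : ∀ i → image G Y i f0 ≈ 0#
      image≈0 i = begin
        G i f0 * ι a + (G i f1 * ι (𝔽.- 𝔽.1#) + (G i f2 * ι 𝔽.0# + (G i f3 * ι 𝔽.0# + 0#)))
          ≈⟨ +-cong (trans (*-congˡ (sym α≈ιa)) (*-comm _ _))
                    (+-cong (trans (*-cong (G₁≈αG₀ i) ι-1) (x*-1≈-x _))
                            (trans (+-cong (*ι0 _) (trans (+-congʳ (*ι0 _)) (+-identityˡ _))) (+-identityˡ _))) ⟩
        α * G i f0 + (- (α * G i f0) + 0#) ≈⟨ +-congˡ (+-identityʳ _) ⟩
        α * G i f0 + - (α * G i f0)        ≈⟨ -‿inverseʳ _ ⟩
        0#                                 ∎

    open Span α α∉F

    basis : Vector Carrier 4
    basis = β V.∷ α * β V.∷ 1# V.∷ α V.∷ V.[]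

    Relation : Vector 𝔽.Carrier 4 → Set
    Relation c = sum (λ l → ι (c l) * basis l) ≈ 0#

    μβ+φ≈0 : ∀ c → Relation c → φ (c f0) (c f1) * β + φ (c f2) (c f3) ≈ 0#
    μβ+φ≈0 c Σ≈0 = trans (+-cong (trans (distribʳ _ _ _) (+-congˡ (trans (*-assoc _ _ _) (x∙yz≈y∙xz α (ι (c f1)) β))))
                                 (sym (+-cong (*-identityʳ _) (trans (+-identityʳ _) (*-comm _ _)))))
                         (trans (+-assoc _ _ _) Σ≈0)

    μ≈0⇒coefficients≈0 : ∀ c → Relation c → φ (c f0) (c f1) ≈ 0# → ∀ l → c l 𝔽.≈ 𝔽.0#
    μ≈0⇒coefficients≈0 c Σ≈0 μ≈0 = λ { f0 → proj₁ c₀,c₁≈0 ; f1 → proj₂ c₀,c₁≈0 ; f2 → proj₁ c₂,c₃≈0 ; f3 → proj₂ c₂,c₃≈0 }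
      where
      c₀,c₁≈0 : c f0 𝔽.≈ 𝔽.0# × c f1 𝔽.≈ 𝔽.0#
      c₀,c₁≈0 = φ≈0⇒≈0 _ _ μ≈0
      c₂,c₃≈0 : c f2 𝔽.≈ 𝔽.0# × c f3 𝔽.≈ 𝔽.0#
      c₂,c₃≈0 = φ≈0⇒≈0 _ _ (trans (sym (+-identityˡ _)) (trans (+-congʳ (sym (trans (*-congʳ μ≈0) (zeroˡ β)))) (μβ+φ≈0 c Σ≈0)))

    -- With μ = c₀ + c₁α ≠ 0, a relation μβ + c₂ + c₃α = 0 gives V = ⟨(c₀, c₁, 1, 0), (-c₂, -c₃, 0, 1)⟩
    -- with both projections nonzero, but image rows x and βx, so ρ(V) = 1 instead of 2.
    μ≉0⇒⊥ : ∀ c → Relation c → ¬ φ (c f0) (c f1) ≈ 0# → ⊥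
    μ≉0⇒⊥ c Σ≈0 μ≉0 = rank≤1 (proj₂ (𝔽.rank-exists (⊕.πₗ Y))) (proj₂ (𝔽.rank-exists (⊕.πᵣ Y)))
      where
      μ : Carrier
      μ = φ (c f0) (c f1)
      μβ≈φ-c : μ * β ≈ φ (𝔽.- c f2) (𝔽.- c f3)
      μβ≈φ-c = trans (inverseˡ-unique _ _ (μβ+φ≈0 c Σ≈0)) (sym (φ-neg (c f2) (c f3)))
      y₀ y₁ : Vector 𝔽.Carrier 4
      y₀ = c f0 V.∷ c f1 V.∷ 𝔽.1# V.∷ 𝔽.0# V.∷ V.[]
      y₁ = 𝔽.- c f2 V.∷ 𝔽.- c f3 V.∷ 𝔽.0# V.∷ 𝔽.1# V.∷ V.[]
      Y : 𝔽.Matrix 2 4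
      Y = 𝔽.rows y₀ y₁
      rY : RankIs F Y 2
      rY = 𝔽.Indep⇒rank Y (𝔽.Indep-rows y₀ y₁ f2 f3 𝔽.refl 𝔽.refl 𝔽.refl 𝔽.refl)
      x : Fin k → Carrier
      x i = G i f0 * μ + G i f2
      G₁ι : ∀ i a → G i f1 * ι a ≈ G i f0 * (α * ι a)
      G₁ι i a = trans (*-congʳ (G₁≈αG₀ i)) (trans (*-congʳ (*-comm _ _)) (*-assoc _ _ _))
      [1,β] : Matrix 1 2
      [1,β] = row (1# V.∷ β V.∷ V.[])
      image⊆[1,β] : RowSub L (image G Y) [1,β]
      image⊆[1,β] i = (λ _ → x i) , λ { f0 → entry₀ ; f1 → entry₁ }
        where
        entry₀ : image G Y i f0 ≈ x i * 1# + 0#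
        entry₀ = begin
          G i f0 * ι (c f0) + (G i f1 * ι (c f1) + (G i f2 * ι 𝔽.1# + (G i f3 * ι 𝔽.0# + 0#)))
            ≈⟨ +-congˡ (+-cong (G₁ι i (c f1)) (trans (+-cong (*ι1 _) (trans (+-congʳ (*ι0 _)) (+-identityˡ _))) (+-identityʳ _))) ⟩
          G i f0 * ι (c f0) + (G i f0 * (α * ι (c f1)) + G i f2)   ≈⟨ +-assoc _ _ _ ⟨
          (G i f0 * ι (c f0) + G i f0 * (α * ι (c f1))) + G i f2   ≈⟨ +-congʳ (distribˡ _ _ _) ⟨
          x i                                                      ≈⟨ trans (+-identityʳ _) (*-identityʳ _) ⟨
          x i * 1# + 0#                                            ∎
        entry₁ : image G Y i f1 ≈ x i * β + 0#
        entry₁ = begin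
          G i f0 * ι (𝔽.- c f2) + (G i f1 * ι (𝔽.- c f3) + (G i f2 * ι 𝔽.0# + (G i f3 * ι 𝔽.1# + 0#)))
            ≈⟨ +-congˡ (+-cong (G₁ι i _) (trans (+-cong (*ι0 _) (+-identityʳ _)) (trans (+-identityˡ _) (*ι1 _)))) ⟩
          G i f0 * ι (𝔽.- c f2) + (G i f0 * (α * ι (𝔽.- c f3)) + G i f3)   ≈⟨ +-assoc _ _ _ ⟨
          (G i f0 * ι (𝔽.- c f2) + G i f0 * (α * ι (𝔽.- c f3))) + G i f3   ≈⟨ +-cong (sym (distribˡ _ _ _)) (G₃≈βG₂ i) ⟩
          G i f0 * φ (𝔽.- c f2) (𝔽.- c f3) + β * G i f2                    ≈⟨ +-cong (*-congˡ (sym μβ≈φ-c)) (*-comm _ _) ⟩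
          G i f0 * (μ * β) + G i f2 * β                                    ≈⟨ +-congʳ (sym (*-assoc _ _ _)) ⟩
          (G i f0 * μ) * β + G i f2 * β                                    ≈⟨ distribʳ _ _ _ ⟨
          x i * β                                                          ≈⟨ +-identityʳ _ ⟨
          x i * β + 0#                                                     ∎
      2≰1 : ¬ 2 ≤ 1
      2≰1 (s≤s ())
      rank≤1 : ∀ {r₁ r₂} → RankIs F (⊕.πₗ Y) r₁ → RankIs F (⊕.πᵣ Y) r₂ → ⊥
      rank≤1 {zero} rY₁ _ = μ≉0 (φ-zero (𝔽.rank0⇒zero (⊕.πₗ Y) rY₁ f0 f0) (𝔽.rank0⇒zero (⊕.πₗ Y) rY₁ f0 f1))
      rank≤1 {suc _} {zero} _ rY₂ = 𝔽.1≉0 (𝔽.rank0⇒zero (⊕.πᵣ Y) rY₂ f0 f0)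
      rank≤1 {suc _} {suc _} rY₁ rY₂ =
        2≰1 (NP.≤-trans (rank-mono (image G Y) [1,β] image⊆[1,β] (rank-image Y rY rY₁ rY₂) r[1,β]) (rank≤rows [1,β] r[1,β]))
        where
        r[1,β] : RankIs L [1,β] (proj₁ (rank-exists [1,β]))
        r[1,β] = proj₂ (rank-exists [1,β])

    basis-independent : ∀ c → Relation c → ∀ l → c l 𝔽.≈ 𝔽.0#
    basis-independent c Σ≈0 with φ (c f0) (c f1) ≟ 0#
    ... | yes μ≈0 = μ≈0⇒coefficients≈0 c Σ≈0 μ≈0
    ... | no  μ≉0 = ⊥-elim (μ≉0⇒⊥ c Σ≈0 μ≉0)

    F⁴↪L : NF ^ 4 ≤ NL
    F⁴↪L = independent⇒NF^r≤NL basis basis-independent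

  F⁴↪L : NF ^ 4 ≤ NL
  F⁴↪L = Columns.F⁴↪L (proj₁ column₁≈α*column₀) (proj₂ column₁≈α*column₀)
                      (proj₁ column₃≈β*column₂) (proj₂ column₃≈β*column₂)

q<q^m : ∀ {q m} → 1 < q → 2 ≤ m → q < q ^ m
q<q^m {q} {m} 1<q 2≤m = P.subst (_< q ^ m) (NP.^-identityʳ q) (NP.^-monoʳ-< q 1<q 2≤m)

q³+q²<q^m : ∀ {q m} → 1 < q → 4 ≤ m → q ^ 3 ℕ.+ q ^ 2 < q ^ m
q³+q²<q^m {suc q} {m} 1<q 4≤m = begin-strict
  suc q ^ 3 ℕ.+ suc q ^ 2        <⟨ NP.+-monoʳ-< (suc q ^ 3) (NP.^-monoʳ-< (suc q) 1<q {2} {3} NP.≤-refl) ⟩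
  suc q ^ 3 ℕ.+ suc q ^ 3        ≡⟨ P.cong (suc q ^ 3 ℕ.+_) (NP.+-identityʳ (suc q ^ 3)) ⟨
  2 ℕ.* suc q ^ 3                ≤⟨ NP.*-monoˡ-≤ (suc q ^ 3) 1<q ⟩
  suc q ^ 4                      ≤⟨ NP.^-monoʳ-≤ (suc q) 4≤m ⟩
  suc q ^ m                      ∎
  where open NP.≤-Reasoning

q^4≤q^m⇒4≤m : ∀ {q m} → 1 < q → q ^ 4 ≤ q ^ m → 4 ≤ m
q^4≤q^m⇒4≤m {q} 1<q q⁴≤q^m = NP.≮⇒≥ (λ m<4 → NP.<⇒≱ (NP.^-monoʳ-< q 1<q m<4) q⁴≤q^m)

uniform-representable : (F L : Field) (E : Extension F L) {NF NL : ℕ} (hsF : HasSize F NF) (hsL : HasSize L NL) →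
                        NF < NL → Representable F L E (Uniform F 1 2)
uniform-representable F L E hsF hsL NF<NL =
  UniformRepresentation.G₁-represents F L E hsF hsL (proj₁ (∃-NotInBase NF<NL)) (proj₂ (∃-NotInBase NF<NL))
  where open ExtensionProperties F L E hsF hsL

direct-sum-representable : (F L : Field) (E : Extension F L) {NF NL : ℕ} (hsF : HasSize F NF) (hsL : HasSize L NL) →
                           NF < NL → NF ^ 3 ℕ.+ NF ^ 2 < NL → Representable F L E (DirectSumRank.U⊕U F hsF)
direct-sum-representable F L E hsF hsL NF<NL #normal<NL =
  DirectSumRepresentation.G₂-represents F L E hsF hsL α α∉F (proj₁ (∃-NotRatio #normal<NL)) (proj₂ (∃-NotRatio #normal<NL))
  where
  open ExtensionProperties F L E hsF hsL
  α : Field.Carrier L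
  α = proj₁ (∃-NotInBase NF<NL)
  α∉F : NotInBase α
  α∉F = proj₂ (∃-NotInBase NF<NL)
  open Span α α∉F

direct-sum-representable⇒ : (F L : Field) (E : Extension F L) {NF NL : ℕ} (hsF : HasSize F NF) (hsL : HasSize L NL) →
                            Representable F L E (DirectSumRank.U⊕U F hsF) → NF ^ 4 ≤ NL
direct-sum-representable⇒ F L E hsF hsL (_ , G , represents) = DirectSumObstruction.F⁴↪L F L E hsF hsL G represents

proposition3p8 :
    (F : Field) (q : ℕ) → HasSize F q →
    ((L : Field) (E : Extension F L) → HasSize L (q ^ 2) →
       Representable F L E (Uniform F 1 2))
    × ((m : ℕ) (L : Field) (E : Extension F L) → HasSize L (q ^ m) →
       (Representable F L E (DirectSum F (Uniform F 1 2) (Uniform F 1 2)) ⇔ 4 ≤ m))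
proposition3p8 F q hsF =
  (λ L E hsL → uniform-representable F L E hsF hsL (q<q^m 1<q NP.≤-refl)) ,
  λ m L E hsL → mk⇔
    (λ representable → q^4≤q^m⇒4≤m 1<q (direct-sum-representable⇒ F L E hsF hsL representable))
    (λ 4≤m → direct-sum-representable F L E hsF hsL (q<q^m 1<q (NP.≤-trans (s≤s (s≤s z≤n)) 4≤m)) (q³+q²<q^m 1<q 4≤m))
  where
  1<q : 1 < q
  1<q = FiniteField.1<N F hsF
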